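{- Let $m,n$ be positive integers. The number $\overline{f}_m(n)$ of Young tableaux with walls over $\mathcal{B}_m^n$ equals the number of lattice paths from $(0,0)$ to $(mn,mn)$ with steps $N=(0,1)$, $E=(1,0)$ that never go below the path $N(E^mN^m)^{n-1}E^mN^{m-1}$. Moreover, $$\overline{f}_m(n)=\det \left(\binom{a_i+1}{j-i+1}\right)_{1\leq i,j\leq nm-1},$$ where $a_i=hm$ for $(h-1)m+1\leq i\leq hm$, $1\leq h\leq n-1$, and $a_{i}=mn$ for $(n-1)m+1\leq i\leq nm-1$.
   Context: A Young tableau with walls over $\mathcal{B}_m^n$ is a filling of the $2\times mn$ rectangle with $1,\dots,2mn$, each once, with rows increasing left to right, and such that in each column $c$ not belonging to the wall set $\{jm+i:0\le j\le n-1,\ 2\le i\le m\}$ the first-row entry is smaller than the second-row entry (no condition in wall columns). Binomial coefficients $\binom{a}{b}$ with $b<0$ are $0$. -}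

module Defs where

open import Data.Nat using (ℕ; zero; suc; _+_; _*_; _∸_; _≤_; _<_; NonZero)
open import Data.Nat.Properties using (_≟_; _≤?_; _<?_)
open import Data.Nat.Combinatorics using (_C_)
open import Data.Nat.DivMod using (_/_)
open import Data.Integer using (ℤ; +_; -[1+_]; 0ℤ; 1ℤ; -_) renaming (_+_ to _+ℤ_; _*_ to _*ℤ_; _-_ to _-ℤ_)
open import Data.Fin using (Fin; zero; suc; toℕ; punchIn)
open import Data.Fin.Properties using (any?; all?)
open import Data.List using (List; []; _∷_; map; length; filter; concatMap; upTo; foldr; allFin; applyUpTo; scanl; last)
open import Data.List.Relation.Unary.All using (All) renaming (all? to allL?)
open import Data.List.Relation.Unary.Any using (Any) renaming (any? to anyL?)
open import Data.List.Relation.Unary.Linked using (Linked; linked?)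
open import Data.Vec using (Vec; []; _∷_; lookup; toList; _++_)
open import Data.Maybe using (Maybe; just)
open import Data.Bool using (Bool; true; false; if_then_else_)
open import Data.Product using (Σ; _×_; _,_; proj₁; proj₂)
open import Data.Product.Properties using (≡-dec)
open import Relation.Nullary using (Dec; yes; no; ¬_; _×-dec_; does)
open import Relation.Nullary.Decidable using (¬?; _→-dec_)
open import Relation.Unary using (Decidable)
open import Relation.Binary.PropositionalEquality using (_≡_)

vecsOver : {A : Set} → List A → (k : ℕ) → List (Vec A k)
vecsOver xs zero    = [] ∷ []
vecsOver xs (suc k) = concatMap (λ x → map (x ∷_) (vecsOver xs k)) xs

oneTo : ℕ → List ℕ
oneTo N = applyUpTo suc N

-- Young tableaux with walls over B_m^n.
-- Columns are numbered 1..mn.  Wall set {j m + i : 0 ≤ j ≤ n-1, 2 ≤ i ≤ m}.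

IsWall : (m n c : ℕ) → Set
IsWall m n c = Σ (Fin n) λ j → Σ (Fin (suc m)) λ i → (2 ≤ toℕ i) × (c ≡ toℕ j * m + toℕ i)

isWall? : (m n c : ℕ) → Dec (IsWall m n c)
isWall? m n c = any? λ j → any? λ i → (2 ≤? toℕ i) ×-dec (c ≟ toℕ j * m + toℕ i)

-- A candidate filling: (first row, second row), each of length mn,
-- entries taken from {1, ..., 2mn}.
Filling : (m n : ℕ) → Set
Filling m n = Vec ℕ (m * n) × Vec ℕ (m * n)

occurrences : ℕ → List ℕ → ℕ
occurrences v xs = length (filter (v ≟_) xs)

IsTableauWithWalls : (m n : ℕ) → Filling m n → Set
IsTableauWithWalls m n (r₁ , r₂) =
    All (λ v → occurrences v (toList (r₁ ++ r₂)) ≡ 1) (oneTo (2 * (m * n)))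
  × Linked _<_ (toList r₁)
  × Linked _<_ (toList r₂)
  × ((k : Fin (m * n)) → ¬ IsWall m n (suc (toℕ k)) → lookup r₁ k < lookup r₂ k)

isTableauWithWalls? : (m n : ℕ) → Decidable (IsTableauWithWalls m n)
isTableauWithWalls? m n (r₁ , r₂) =
  allL? (λ v → occurrences v (toList (r₁ ++ r₂)) ≟ 1) (oneTo (2 * (m * n)))
  ×-dec linked? _<?_ (toList r₁)
  ×-dec linked? _<?_ (toList r₂)
  ×-dec all? (λ k → ¬? (isWall? m n (suc (toℕ k))) →-dec (lookup r₁ k <? lookup r₂ k))

allFillings : (m n : ℕ) → List (Filling m n)
allFillings m n = concatMap (λ r₁ → map (r₁ ,_) (vecsOver (oneTo (2 * (m * n))) (m * n)))
                            (vecsOver (oneTo (2 * (m * n))) (m * n))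

fBar : (m n : ℕ) → ℕ
fBar m n = length (filter (isTableauWithWalls? m n) (allFillings m n))

data Step : Set where
  N E : Step

step-dec : (s t : Step) → Dec (s ≡ t)
step-dec N N = yes _≡_.refl
step-dec N E = no λ ()
step-dec E N = no λ ()
step-dec E E = yes _≡_.refl

move : ℕ × ℕ → Step → ℕ × ℕ
move (x , y) N = (x , suc y)
move (x , y) E = (suc x , y)

points : List Step → List (ℕ × ℕ)
points = scanl move (0 , 0)

endPoint : List Step → ℕ × ℕ
endPoint w = Data.List.foldl move (0 , 0) w

rep : ℕ → List Step → List Step
rep zero    w = []
rep (suc k) w = w Data.List.++ rep k w

boundary : (m n : ℕ) → List Step
boundary m n = N ∷ (rep (n ∸ 1) (rep m (E ∷ []) Data.List.++ rep m (N ∷ []))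
                    Data.List.++ (rep m (E ∷ []) Data.List.++ rep (m ∸ 1) (N ∷ [])))

NeverBelow : List Step → List Step → Set
NeverBelow P Q = All (λ p → Any (λ q → (proj₁ q ≡ proj₁ p) × (proj₂ q ≤ proj₂ p)) (points Q)) (points P)

neverBelow? : (P Q : List Step) → Dec (NeverBelow P Q)
neverBelow? P Q = allL? (λ p → anyL? (λ q → (proj₁ q ≟ proj₁ p) ×-dec (proj₂ q ≤? proj₂ p)) (points Q)) (points P)

-- a path from (0,0) to (mn,mn) has exactly 2mn steps
IsGoodPath : (m n : ℕ) → Vec Step (2 * (m * n)) → Set
IsGoodPath m n w = (endPoint (toList w) ≡ (m * n , m * n)) × NeverBelow (toList w) (boundary m n)

isGoodPath? : (m n : ℕ) → Decidable (IsGoodPath m n)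
isGoodPath? m n w = ≡-dec _≟_ _≟_ (endPoint (toList w)) (m * n , m * n)
                    ×-dec neverBelow? (toList w) (boundary m n)

numPaths : (m n : ℕ) → ℕ
numPaths m n = length (filter (isGoodPath? m n) (vecsOver (N ∷ E ∷ []) (2 * (m * n))))

sumFin : (k : ℕ) → (Fin k → ℤ) → ℤ
sumFin k f = foldr _+ℤ_ 0ℤ (map f (allFin k))

sign : ℕ → ℤ
sign zero          = 1ℤ
sign (suc zero)    = - 1ℤ
sign (suc (suc j)) = sign j

det : (k : ℕ) → (Fin k → Fin k → ℤ) → ℤ
det zero    A = 1ℤ
det (suc k) A = sumFin (suc k) λ j →
  sign (toℕ j) *ℤ (A zero j *ℤ det k (λ r c → A (suc r) (punchIn j c)))

binomℤ : ℕ → ℤ → ℤ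
binomℤ a (+ b)     = + (a C b)
binomℤ a -[1+ _ ]  = 0ℤ

-- a_i (1 ≤ i ≤ nm-1): a_i = h m for (h-1)m+1 ≤ i ≤ hm, 1 ≤ h ≤ n-1
-- (i.e. h = ⌈i/m⌉), and a_i = mn for (n-1)m+1 ≤ i ≤ nm-1.
aSeq : (m n : ℕ) .{{_ : NonZero m}} → ℕ → ℕ
aSeq m n i = if does (i ≤? (n ∸ 1) * m) then ((i + (m ∸ 1)) / m) * m else m * n

wallMatrix : (m n : ℕ) .{{_ : NonZero m}} → Fin (m * n ∸ 1) → Fin (m * n ∸ 1) → ℤ
wallMatrix m n i j =
  binomℤ (aSeq m n (suc (toℕ i)) + 1) ((+ suc (toℕ j) -ℤ + suc (toℕ i)) +ℤ 1ℤ)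

{-# OPTIONS --safe #-}

-- Read a filling of the 2 × mn rectangle as a lattice word: position v ∈ {1, …, 2mn} is a north step
-- if v lies in the first row and an east step if it lies in the second.  At a non-wall column c the
-- condition "first row < second row" says that the path has reached height c when it enters column c.
-- The boundary path enters column jm + 1 at height jm + 1 and keeps that height over the wall columns
-- jm + 2, …, jm + m, where nothing new is required.  So tableaux with walls are exactly the paths that
-- never go below the boundary, i.e. that leave height t + 1 from a column ≤ a_{t+1}.
--
-- Counting such paths by inclusion–exclusion over how far they run east on their first row (Pascal's
-- rule for the binomial weights) gives
--   P(k + 1, t) = Σ_{j ≤ k} (-1)^j C(a_{t+1} + 1, j + 1) P(k - j, t + j + 1).
-- The matrix (C(a_i + 1, j - i + 1)) is unit lower Hessenberg, so expanding its determinant along the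
-- first row leaves trailing principal minors, and it satisfies the same recursion.

module Submission where

open import Data.Nat using (ℕ)

module Determinants where

  open import Defs using (det; sumFin; sign)
  open import Data.Nat using (ℕ; zero; suc; _∸_; _<_; _≤_; z≤n; s≤s; s≤s⁻¹)
    renaming (_+_ to _+ℕ_)
  open import Data.Integer using (ℤ; 0ℤ; 1ℤ; -_; _+_; _*_)
  import Data.Integer.Properties as ℤ
  open import Data.Integer.Tactic.RingSolver using (solve-∀)
  open import Data.Fin using (Fin; zero; suc; toℕ; punchIn)
  open import Data.List using (foldr; allFin)
  import Data.List.Properties as List
  open import Function using (_∘_)
  open import Relation.Binary.PropositionalEquality

  Matrix : Set
  Matrix = ℕ → ℕ → ℤ

  detℕ : ℕ → Matrix → ℤ
  detℕ k M = det k (λ r c → M (toℕ r) (toℕ c))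

  sumBelow : ℕ → (ℕ → ℤ) → ℤ
  sumBelow zero    f = 0ℤ
  sumBelow (suc k) f = f 0 + sumBelow k (f ∘ suc)

  sumBelow-cong : ∀ k {f g : ℕ → ℤ} → (∀ {j} → j < k → f j ≡ g j) →
                  sumBelow k f ≡ sumBelow k g
  sumBelow-cong zero    p = refl
  sumBelow-cong (suc k) p = cong₂ _+_ (p (s≤s z≤n)) (sumBelow-cong k (p ∘ s≤s))

  sumBelow-zero : ∀ k {f : ℕ → ℤ} → (∀ j → f j ≡ 0ℤ) → sumBelow k f ≡ 0ℤ
  sumBelow-zero zero    p = refl
  sumBelow-zero (suc k) p = cong₂ _+_ (p 0) (sumBelow-zero k (p ∘ suc))

  sumBelow-neg : ∀ k (f : ℕ → ℤ) → sumBelow k (λ j → - f j) ≡ - sumBelow k f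
  sumBelow-neg zero    f = refl
  sumBelow-neg (suc k) f =
    trans (cong (- f 0 +_) (sumBelow-neg k (f ∘ suc))) (sym (ℤ.neg-distrib-+ (f 0) _))

  sign-suc : ∀ j → sign (suc j) ≡ - sign j
  sign-suc zero          = refl
  sign-suc (suc zero)    = refl
  sign-suc (suc (suc j)) = sign-suc j

  sumFin-cong : ∀ k {f g : Fin k → ℤ} → (∀ j → f j ≡ g j) → sumFin k f ≡ sumFin k g
  sumFin-cong k p = cong (foldr _+_ 0ℤ) (List.map-cong p (allFin k))

  sumFin-suc : ∀ k (f : Fin (suc k) → ℤ) → sumFin (suc k) f ≡ f zero + sumFin k (f ∘ suc)
  sumFin-suc k f = cong (λ xs → f zero + foldr _+_ 0ℤ xs)
    (trans (List.map-tabulate suc f) (sym (List.map-tabulate (λ j → j) (f ∘ suc))))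

  sumFin≡sumBelow : ∀ k {f : Fin k → ℤ} (g : ℕ → ℤ) → (∀ j → f j ≡ g (toℕ j)) →
                    sumFin k f ≡ sumBelow k g
  sumFin≡sumBelow zero        g p = refl
  sumFin≡sumBelow (suc k) {f} g p =
    trans (sumFin-suc k f) (cong₂ _+_ (p zero) (sumFin≡sumBelow k (g ∘ suc) (p ∘ suc)))

  det-cong : ∀ k {A B : Fin k → Fin k → ℤ} → (∀ r c → A r c ≡ B r c) → det k A ≡ det k B
  det-cong zero    p = refl
  det-cong (suc k) p = sumFin-cong (suc k) λ j →
    cong₂ (λ a d → sign (toℕ j) * (a * d)) (p zero j) (det-cong k λ r c → p (suc r) (punchIn j c))

  detℕ-cong : ∀ k {M M′ : Matrix} → (∀ r c → M r c ≡ M′ r c) → detℕ k M ≡ detℕ k M′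
  detℕ-cong k p = det-cong k λ r c → p (toℕ r) (toℕ c)

  punchInℕ : ℕ → ℕ → ℕ
  punchInℕ zero    c       = suc c
  punchInℕ (suc j) zero    = zero
  punchInℕ (suc j) (suc c) = suc (punchInℕ j c)

  toℕ-punchIn : ∀ {k} (j : Fin (suc k)) (c : Fin k) →
                toℕ (punchIn j c) ≡ punchInℕ (toℕ j) (toℕ c)
  toℕ-punchIn zero    c       = refl
  toℕ-punchIn (suc j) zero    = refl
  toℕ-punchIn (suc j) (suc c) = cong suc (toℕ-punchIn j c)

  minor : ℕ → Matrix → Matrix
  minor j M r c = M (suc r) (punchInℕ j c)

  shift : ℕ → Matrix → Matrix
  shift s M r c = M (s +ℕ r) (s +ℕ c)

  det-expand : ∀ k M →
               detℕ (suc k) M ≡ sumBelow (suc k) (λ j → sign j * (M 0 j * detℕ k (minor j M)))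
  det-expand k M = sumFin≡sumBelow (suc k) (λ j → sign j * (M 0 j * detℕ k (minor j M))) λ j →
    cong (λ d → sign (toℕ j) * (M 0 (toℕ j) * d))
         (det-cong k λ r c → cong (M (suc (toℕ r))) (toℕ-punchIn j c))

  det-lowerZeroColumn : ∀ k M → (∀ r → M (suc r) 0 ≡ 0ℤ) →
                        detℕ (suc k) M ≡ M 0 0 * detℕ k (shift 1 M)
  det-lowerZeroColumn zero M _ = trans (det-expand 0 M) (unit (M 0 0))
    where
    unit : ∀ a → 1ℤ * (a * 1ℤ) + 0ℤ ≡ a * 1ℤ
    unit = solve-∀
  det-lowerZeroColumn (suc k) M zeros = begin
      detℕ (suc (suc k)) M
    ≡⟨ det-expand (suc k) M ⟩
      1ℤ * (M 0 0 * detℕ (suc k) (shift 1 M)) + sumBelow (suc k) later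
    ≡⟨ cong (1ℤ * (M 0 0 * detℕ (suc k) (shift 1 M)) +_) (sumBelow-zero (suc k) laterVanish) ⟩
      1ℤ * (M 0 0 * detℕ (suc k) (shift 1 M)) + 0ℤ
    ≡⟨ unit (M 0 0 * detℕ (suc k) (shift 1 M)) ⟩
      M 0 0 * detℕ (suc k) (shift 1 M) ∎
    where
    open ≡-Reasoning
    later : ℕ → ℤ
    later j = sign (suc j) * (M 0 (suc j) * detℕ (suc k) (minor (suc j) M))
    laterVanish : ∀ j → later j ≡ 0ℤ
    laterVanish j = begin
        later j
      ≡⟨ cong (λ d → sign (suc j) * (M 0 (suc j) * d))
              (det-lowerZeroColumn k (minor (suc j) M) (zeros ∘ suc)) ⟩
        sign (suc j) * (M 0 (suc j) * (M 1 0 * D))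
      ≡⟨ cong (λ a → sign (suc j) * (M 0 (suc j) * (a * D))) (zeros 0) ⟩
        sign (suc j) * (M 0 (suc j) * (0ℤ * D))
      ≡⟨ vanish (sign (suc j)) (M 0 (suc j)) D ⟩
        0ℤ ∎
      where
      D : ℤ
      D = detℕ k (shift 1 (minor (suc j) M))
      vanish : ∀ s a d → s * (a * (0ℤ * d)) ≡ 0ℤ
      vanish = solve-∀
    unit : ∀ a → 1ℤ * a + 0ℤ ≡ a
    unit = solve-∀

  record IsUnitHessenberg (M : Matrix) : Set where
    field
      subdiagonal      : ∀ c → M (suc c) c ≡ 1ℤ
      belowSubdiagonal : ∀ {r c} → suc c < r → M r c ≡ 0ℤ

  shift₁-isUnitHessenberg : ∀ {M} → IsUnitHessenberg M → IsUnitHessenberg (shift 1 M)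
  shift₁-isUnitHessenberg H = record
    { subdiagonal      = subdiagonal ∘ suc
    ; belowSubdiagonal = belowSubdiagonal ∘ s≤s
    }
    where open IsUnitHessenberg H

  -- In the first j columns of the minor the unit subdiagonal of M becomes the diagonal, with only zeros
  -- below it, so these columns peel off one at a time.
  hessenberg-minor : ∀ {j k M} → IsUnitHessenberg M → j ≤ k →
                     detℕ k (minor j M) ≡ detℕ (k ∸ j) (shift (suc j) M)
  hessenberg-minor {zero}              H _         = refl
  hessenberg-minor {suc j} {suc k} {M} H (s≤s j≤k) = begin
      detℕ (suc k) (minor (suc j) M)
    ≡⟨ det-lowerZeroColumn k (minor (suc j) M) (λ r → belowSubdiagonal (s≤s (s≤s z≤n))) ⟩
      M 1 0 * detℕ k (minor j (shift 1 M))
    ≡⟨ cong₂ _*_ (subdiagonal 0) (hessenberg-minor (shift₁-isUnitHessenberg H) j≤k) ⟩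
      1ℤ * detℕ (k ∸ j) (shift (suc (suc j)) M)
    ≡⟨ ℤ.*-identityˡ _ ⟩
      detℕ (k ∸ j) (shift (suc (suc j)) M) ∎
    where
    open ≡-Reasoning
    open IsUnitHessenberg H

  hessenberg-expand : ∀ k {M} → IsUnitHessenberg M →
    detℕ (suc k) M ≡ sumBelow (suc k) (λ j → sign j * (M 0 j * detℕ (k ∸ j) (shift (suc j) M)))
  hessenberg-expand k {M} H = trans (det-expand k M) (sumBelow-cong (suc k) λ {j} j<1+k →
    cong (λ d → sign j * (M 0 j * d)) (hessenberg-minor H (s≤s⁻¹ j<1+k)))

module BoundedPaths where

  open import Data.Nat using (ℕ; zero; suc; _+_; _∸_; _≤_; _<_)
  open import Data.Nat.Properties using (+-∸-assoc; m≤n⇒m∸n≡0)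
  open import Relation.Binary.PropositionalEquality

  sumFrom : ℕ → ℕ → (ℕ → ℕ) → ℕ
  sumFrom x zero    f = 0
  sumFrom x (suc l) f = f x + sumFrom (suc x) l f

  -- paths b k t x counts the lattice paths that start at column x of row t and take k north
  -- steps, where on every row t′ < t + k the path leaves northwards from a column ≤ b t′.
  module _ (b : ℕ → ℕ) where

    paths : ℕ → ℕ → ℕ → ℕ
    paths zero    t x = 1
    paths (suc k) t x = sumFrom x (suc (b t) ∸ x) (paths k (suc t))

    paths-split : ∀ k t x → x ≤ b t → paths (suc k) t x ≡ paths k (suc t) x + paths (suc k) t (suc x)
    paths-split k t x x≤b rewrite +-∸-assoc 1 x≤b = refl

    paths-beyond : ∀ k t x → b t < x → paths (suc k) t x ≡ 0
    paths-beyond k t x b<x rewrite m≤n⇒m∸n≡0 b<x = refl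

module PathExpansion where

  open import Defs using (sign)
  open Determinants using (sumBelow; sumBelow-cong; sumBelow-neg; sign-suc)
  open BoundedPaths using (paths; paths-split; paths-beyond)
  open import Data.Nat using (ℕ; zero; suc; _∸_; _≤_; _<_) renaming (_+_ to _+ℕ_)
  import Data.Nat.Properties as ℕ
  open import Data.Nat.Combinatorics using (_C_; nCk+nC[k+1]≡[n+1]C[k+1])
  open import Data.Integer using (ℤ; +_; 0ℤ; 1ℤ; -_; _+_; _*_; _-_)
  import Data.Integer.Properties as ℤ
  open import Data.Integer.Tactic.RingSolver using (solve-∀)
  open import Function using (_∘_)
  open import Relation.Binary.PropositionalEquality

  altSum : (ℕ → ℤ) → (ℕ → ℕ → ℤ) → ℕ → ℕ → ℤ
  altSum c Q zero    t = c 0 * Q 0 (suc t)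
  altSum c Q (suc k) t = c 0 * Q (suc k) (suc t) - altSum (c ∘ suc) Q k (suc t)

  altSum≡sumBelow : ∀ c Q k t →
                 altSum c Q k t ≡ sumBelow (suc k) (λ j → sign j * (c j * Q (k ∸ j) (suc j +ℕ t)))
  altSum≡sumBelow c Q zero    t = sym (trans (ℤ.+-identityʳ _) (ℤ.*-identityˡ _))
  altSum≡sumBelow c Q (suc k) t = begin
      c 0 * Q (suc k) (suc t) - altSum (c ∘ suc) Q k (suc t)
    ≡⟨ cong (λ s → c 0 * Q (suc k) (suc t) - s) (altSum≡sumBelow (c ∘ suc) Q k (suc t)) ⟩
      c 0 * Q (suc k) (suc t) - sumBelow (suc k) term
    ≡⟨ cong₂ _+_ (sym (ℤ.*-identityˡ (c 0 * Q (suc k) (suc t))))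
                 (sym (trans (sumBelow-cong (suc k) (λ {j} _ → nextTerm j)) (sumBelow-neg (suc k) term))) ⟩
      1ℤ * (c 0 * Q (suc k) (suc t)) +
      sumBelow (suc k) (λ j → sign (suc j) * (c (suc j) * Q (k ∸ j) (suc (suc j) +ℕ t))) ∎
    where
    open ≡-Reasoning
    term : ℕ → ℤ
    term j = sign j * (c (suc j) * Q (k ∸ j) (suc j +ℕ suc t))
    nextTerm : ∀ j → sign (suc j) * (c (suc j) * Q (k ∸ j) (suc (suc j) +ℕ t)) ≡ - term j
    nextTerm j = trans (cong₂ (λ s u → s * (c (suc j) * Q (k ∸ j) (suc u)))
                              (sign-suc j) (sym (ℕ.+-suc j t)))
      (sym (ℤ.neg-distribˡ-* (sign j) _))

  altSum-congˡ : ∀ {c c′} Q k t → (∀ j → c j ≡ c′ j) → altSum c Q k t ≡ altSum c′ Q k t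
  altSum-congˡ Q zero    t p = cong (_* Q 0 (suc t)) (p 0)
  altSum-congˡ Q (suc k) t p =
    cong₂ (λ a s → a * Q (suc k) (suc t) - s) (p 0) (altSum-congˡ Q k (suc t) (p ∘ suc))

  altSum-congʳ : ∀ c {Q Q′} k t → (∀ i {t′} → t < t′ → Q i t′ ≡ Q′ i t′) →
              altSum c Q k t ≡ altSum c Q′ k t
  altSum-congʳ c zero    t p = cong (c 0 *_) (p 0 ℕ.≤-refl)
  altSum-congʳ c (suc k) t p = cong₂ (λ q s → c 0 * q - s) (p (suc k) ℕ.≤-refl)
    (altSum-congʳ (c ∘ suc) k (suc t) λ i t+1<t′ → p i (ℕ.<-trans (ℕ.n<1+n t) t+1<t′))

  altSum-zeroˡ : ∀ {c} Q k t → (∀ j → c j ≡ 0ℤ) → altSum c Q k t ≡ 0ℤ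
  altSum-zeroˡ Q zero    t p rewrite p 0 = refl
  altSum-zeroˡ Q (suc k) t p rewrite p 0 | altSum-zeroˡ Q k (suc t) (p ∘ suc) = refl

  altSum-+ˡ : ∀ c c′ Q k t → altSum (λ j → c j + c′ j) Q k t ≡ altSum c Q k t + altSum c′ Q k t
  altSum-+ˡ c c′ Q zero    t = ℤ.*-distribʳ-+ (Q 0 (suc t)) (c 0) (c′ 0)
  altSum-+ˡ c c′ Q (suc k) t rewrite altSum-+ˡ (c ∘ suc) (c′ ∘ suc) Q k (suc t) =
    distrib (c 0) (c′ 0) (Q (suc k) (suc t)) (altSum (c ∘ suc) Q k (suc t)) (altSum (c′ ∘ suc) Q k (suc t))
    where
    distrib : ∀ a a′ q s s′ → (a + a′) * q - (s + s′) ≡ (a * q - s) + (a′ * q - s′)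
    distrib = solve-∀

  altSum-+ʳ : ∀ c Q Q′ k t →
              altSum c (λ i t′ → Q i t′ + Q′ i t′) k t ≡ altSum c Q k t + altSum c Q′ k t
  altSum-+ʳ c Q Q′ zero    t = ℤ.*-distribˡ-+ (c 0) _ _
  altSum-+ʳ c Q Q′ (suc k) t rewrite altSum-+ʳ (c ∘ suc) Q Q′ k (suc t) =
    distrib (c 0) (Q (suc k) (suc t)) (Q′ (suc k) (suc t))
            (altSum (c ∘ suc) Q k (suc t)) (altSum (c ∘ suc) Q′ k (suc t))
    where
    distrib : ∀ a q q′ s s′ → a * (q + q′) - (s + s′) ≡ (a * q - s) + (a * q′ - s′)
    distrib = solve-∀

  northFirst : (ℕ → ℕ → ℤ) → ℕ → ℕ → ℤ
  northFirst Q zero    t = 0ℤ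
  northFirst Q (suc i) t = Q i (suc t)

  altSum-northFirst : ∀ c Q k t → altSum c (northFirst Q) (suc k) t ≡ altSum c Q k (suc t)
  altSum-northFirst c Q zero    t =
    trans (cong (λ z → c 0 * Q 0 (suc (suc t)) - z) (ℤ.*-zeroʳ (c 1))) (ℤ.+-identityʳ _)
  altSum-northFirst c Q (suc k) t =
    cong (λ s → c 0 * Q (suc k) (suc (suc t)) - s) (altSum-northFirst (c ∘ suc) Q k (suc t))

  altSum-telescope : ∀ {c} Q k t → c 0 ≡ 1ℤ →
                  altSum c Q k t + altSum (c ∘ suc) (northFirst Q) k t ≡ Q k (suc t)
  altSum-telescope {c} Q zero    t c₀≡1 rewrite c₀≡1 = cancel (c 1) (Q 0 (suc t))
    where
    cancel : ∀ a q → 1ℤ * q + a * 0ℤ ≡ q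
    cancel = solve-∀
  altSum-telescope {c} Q (suc k) t c₀≡1 rewrite c₀≡1 | altSum-northFirst (c ∘ suc) Q k t =
    cancel (Q (suc k) (suc t)) (altSum (c ∘ suc) Q k (suc t))
    where
    cancel : ∀ q s → (1ℤ * q - s) + s ≡ q
    cancel = solve-∀

  module _ (b : ℕ → ℕ) (b-mono : ∀ {t t′} → t ≤ t′ → b t ≤ b t′) where

    pathsFrom : ℕ → ℕ → ℕ → ℤ
    pathsFrom x k t = + paths b k t x

    pathsFrom-split : ∀ {x t} → x ≤ b t → ∀ k {t′} → t ≤ t′ →
                      pathsFrom x k t′ ≡ pathsFrom (suc x) k t′ + northFirst (pathsFrom x) k t′
    pathsFrom-split x≤b zero    t≤t′ = refl
    pathsFrom-split {x} x≤b (suc k) {t′} t≤t′ = begin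
        + paths b (suc k) t′ x
      ≡⟨ cong +_ (paths-split b k t′ x (ℕ.≤-trans x≤b (b-mono t≤t′))) ⟩
        + (paths b k (suc t′) x +ℕ paths b (suc k) t′ (suc x))
      ≡⟨ cong +_ (ℕ.+-comm (paths b k (suc t′) x) (paths b (suc k) t′ (suc x))) ⟩
        + (paths b (suc k) t′ (suc x) +ℕ paths b k (suc t′) x)
      ≡⟨ ℤ.pos-+ (paths b (suc k) t′ (suc x)) (paths b k (suc t′) x) ⟩
        pathsFrom (suc x) (suc k) t′ + northFirst (pathsFrom x) (suc k) t′ ∎
      where open ≡-Reasoning

    -- d = b t + 1 - x columns of row t remain available; Pascal's rule C(d + 1, j + 1) = C(d, j) + C(d, j + 1)
    -- matches the split of a path according to whether it leaves row t at column x or further east.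
    paths-inclusionExclusion : ∀ k t d x → d +ℕ x ≡ suc (b t) →
                               pathsFrom x (suc k) t ≡ altSum (λ j → + (d C suc j)) (pathsFrom x) k t
    paths-inclusionExclusion k t zero x x≡1+b =
      trans (cong +_ (paths-beyond b k t x (ℕ.≤-reflexive (sym x≡1+b))))
            (sym (altSum-zeroˡ (pathsFrom x) k t (λ _ → refl)))
    paths-inclusionExclusion k t (suc d) x d+1+x≡1+b = sym (begin
        altSum (λ j → + (suc d C suc j)) (pathsFrom x) k t
      ≡⟨ altSum-congˡ (pathsFrom x) k t pascal ⟩
        altSum (λ j → c j + c (suc j)) (pathsFrom x) k t
      ≡⟨ altSum-+ˡ c (c ∘ suc) (pathsFrom x) k t ⟩
        altSum c (pathsFrom x) k t + altSum (c ∘ suc) (pathsFrom x) k t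
      ≡⟨ cong (λ s → altSum c (pathsFrom x) k t + s)
              (trans (altSum-congʳ (c ∘ suc) k t (λ i t<t′ → pathsFrom-split x≤b i (ℕ.<⇒≤ t<t′)))
                     (altSum-+ʳ (c ∘ suc) (pathsFrom (suc x)) (northFirst (pathsFrom x)) k t)) ⟩
        altSum c (pathsFrom x) k t +
        (altSum (c ∘ suc) (pathsFrom (suc x)) k t + altSum (c ∘ suc) (northFirst (pathsFrom x)) k t)
      ≡⟨ swap (altSum c (pathsFrom x) k t) (altSum (c ∘ suc) (pathsFrom (suc x)) k t) _ ⟩
        altSum (c ∘ suc) (pathsFrom (suc x)) k t +
        (altSum c (pathsFrom x) k t + altSum (c ∘ suc) (northFirst (pathsFrom x)) k t)
      ≡⟨ cong₂ _+_ (sym (paths-inclusionExclusion k t d (suc x) (trans (ℕ.+-suc d x) d+1+x≡1+b)))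
                   (altSum-telescope (pathsFrom x) k t refl) ⟩
        pathsFrom (suc x) (suc k) t + pathsFrom x k (suc t)
      ≡⟨ sym (pathsFrom-split x≤b (suc k) ℕ.≤-refl) ⟩
        pathsFrom x (suc k) t ∎)
      where
      open ≡-Reasoning
      c : ℕ → ℤ
      c j = + (d C j)
      pascal : ∀ j → + (suc d C suc j) ≡ c j + c (suc j)
      pascal j = trans (cong +_ (sym (nCk+nC[k+1]≡[n+1]C[k+1] d j))) (ℤ.pos-+ (d C j) (d C suc j))
      x≤b : x ≤ b t
      x≤b = ℕ.≤-trans (ℕ.m≤n+m x d) (ℕ.≤-reflexive (ℕ.suc-injective d+1+x≡1+b))
      swap : ∀ a a′ s → a + (a′ + s) ≡ a′ + (a + s)
      swap = solve-∀

    paths-expand : ∀ k t → + paths b (suc k) t 0 ≡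
      sumBelow (suc k) (λ j → sign j * (+ (suc (b t) C suc j) * + paths b (k ∸ j) (suc j +ℕ t) 0))
    paths-expand k t = trans (paths-inclusionExclusion k t (suc (b t)) 0 (ℕ.+-identityʳ _))
                             (altSum≡sumBelow (λ j → + (suc (b t) C suc j)) (pathsFrom 0) k t)

module BinomialDeterminant where

  open import Defs using (binomℤ; sign)
  open Determinants
  open BoundedPaths using (paths)
  open PathExpansion using (paths-expand)
  open import Data.Nat using (ℕ; zero; suc; _+_; _∸_; _≤_; _<_; s≤s)
  open import Data.Nat.Properties using (+-suc; +-assoc; +-comm; +-identityʳ; m∸n≤m)
  open import Data.Nat.Induction using (<-rec)
  open import Data.Nat.Combinatorics using (_C_)
  open import Data.Integer using (+_; 0ℤ; _⊖_) renaming (_*_ to _*ℤ_)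
  open import Data.Integer.Properties using ([1+m]⊖[1+n]≡m⊖n; +-cancelˡ-⊖; n⊖n≡0)
  open import Relation.Binary.PropositionalEquality

  -- Entry (r, c) is C(b r + 1, c - r + 1), zero for c + 1 < r; with b t = a (t + 1) this is the matrix of the
  -- statement, indexed from 0.
  binomialMatrix : (ℕ → ℕ) → Matrix
  binomialMatrix b r c = binomℤ (suc (b r)) (suc c ⊖ r)

  binomℤ-⊖-< : ∀ a {m n} → m < n → binomℤ a (m ⊖ n) ≡ 0ℤ
  binomℤ-⊖-< a {zero}  {suc n} _         = refl
  binomℤ-⊖-< a {suc m} {suc n} (s≤s m<n) =
    trans (cong (binomℤ a) ([1+m]⊖[1+n]≡m⊖n m n)) (binomℤ-⊖-< a m<n)

  shift-binomialMatrix : ∀ b t r c →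
                         shift t (binomialMatrix b) r c ≡ binomℤ (suc (b (t + r))) (suc c ⊖ r)
  shift-binomialMatrix b t r c =
    cong (binomℤ _) (trans (cong (_⊖ (t + r)) (sym (+-suc t c))) (+-cancelˡ-⊖ t (suc c) r))

  binomialMatrix-isUnitHessenberg : ∀ b t → IsUnitHessenberg (shift t (binomialMatrix b))
  binomialMatrix-isUnitHessenberg b t = record
    { subdiagonal      = λ c → trans (shift-binomialMatrix b t (suc c) c)
                                      (cong (binomℤ _) (n⊖n≡0 (suc c)))
    ; belowSubdiagonal = λ {r} {c} c+1<r → trans (shift-binomialMatrix b t r c)
                                                 (binomℤ-⊖-< _ c+1<r)
    }

  module _ (b : ℕ → ℕ) (b-mono : ∀ {t t′} → t ≤ t′ → b t ≤ b t′) where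

    det-binomialMatrix : ∀ k t → detℕ k (shift t (binomialMatrix b)) ≡ + paths b k t 0
    det-binomialMatrix = <-rec (λ k → ∀ t → detℕ k (shift t B) ≡ + paths b k t 0) step
      where
      B : Matrix
      B = binomialMatrix b
      step : ∀ k → (∀ {k′} → k′ < k → ∀ t → detℕ k′ (shift t B) ≡ + paths b k′ t 0) →
             ∀ t → detℕ k (shift t B) ≡ + paths b k t 0
      step zero    _   t = refl
      step (suc k) ih t = begin
          detℕ (suc k) (shift t B)
        ≡⟨ hessenberg-expand k (binomialMatrix-isUnitHessenberg b t) ⟩
          sumBelow (suc k) (λ j → sign j *ℤ (shift t B 0 j *ℤ detℕ (k ∸ j) (shift (suc j) (shift t B))))
        ≡⟨ sumBelow-cong (suc k) (λ {j} _ → cong₂ (λ a d → sign j *ℤ (a *ℤ d)) (firstRow j)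
             (trans (detℕ-cong (k ∸ j) (shift-shift j)) (ih (s≤s (m∸n≤m k j)) (suc j + t)))) ⟩
          sumBelow (suc k) (λ j → sign j *ℤ (+ (suc (b t) C suc j) *ℤ + paths b (k ∸ j) (suc j + t) 0))
        ≡⟨ sym (paths-expand b b-mono k t) ⟩
          + paths b (suc k) t 0 ∎
        where
        open ≡-Reasoning
        firstRow : ∀ j → shift t B 0 j ≡ + (suc (b t) C suc j)
        firstRow j = trans (shift-binomialMatrix b t 0 j)
                           (cong (λ s → binomℤ (suc (b s)) (+ suc j)) (+-identityʳ t))
        shift-shift : ∀ j r c → shift (suc j) (shift t B) r c ≡ shift (suc j + t) B r c
        shift-shift j r c = cong₂ B (reassoc r) (reassoc c)
          where
          reassoc : ∀ x → t + (suc j + x) ≡ suc j + t + x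
          reassoc x = trans (sym (+-assoc t (suc j) x)) (cong (_+ x) (+-comm t (suc j)))

module Enumeration where

  open import Defs using (vecsOver; oneTo; allFillings)
  open import Data.Nat using (ℕ; zero; suc; _+_; _*_; _<_; _≤_; s≤s; z≤n)
  open import Data.Nat.Properties
    using (≤-refl; <-irrefl; <-trans; <-≤-trans; ≤-trans; ≤-reflexive; <⇒≤; ≤-antisym; n<1+n; m≤m+n;
           +-suc; +-identityʳ; suc-injective; m≤n⇒m<n∨m≡n)
  open import Data.List
    using (List; []; _∷_; _++_; map; filter; length; concatMap; cartesianProductWith; cartesianProduct)
  open import Data.List.Properties using (length-map; map-∘; map-id-local)
  open import Data.List.Relation.Unary.All as All using (All; []; _∷_)
  open import Data.List.Relation.Unary.AllPairs using (AllPairs; []; _∷_)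
  open import Data.List.Relation.Unary.Any using (here; there)
  open import Data.List.Relation.Unary.Unique.Propositional using (Unique)
  import Data.List.Relation.Unary.Unique.Propositional.Properties as Unique
  open import Data.List.Membership.Propositional using (_∈_)
  open import Data.List.Membership.Propositional.Properties
    using (∈-filter⁺; ∈-filter⁻; ∈-map⁺; ∈-map⁻; ∈-applyUpTo⁺; ∈-applyUpTo⁻; ∈-cartesianProduct⁺;
           ∈-cartesianProduct⁻; ∈-cartesianProductWith⁺; ∈-cartesianProductWith⁻)
  open import Data.List.Membership.Propositional.Properties.WithK using (unique∧set⇒bag)
  open import Data.List.Relation.Binary.BagAndSetEquality using (∼bag⇒↭)
  open import Data.List.Relation.Binary.Permutation.Propositional.Properties using (↭-length)
  open import Data.Vec using (Vec; toList) renaming ([] to []ᵥ; _∷_ to _∷ᵥ_)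
  import Data.Vec.Properties as Vec
  open import Data.Product using (_×_; _,_; proj₁; proj₂)
  open import Data.Sum using (inj₁; inj₂)
  open import Data.Empty using (⊥-elim)
  open import Function using (_∘_; _⇔_; mk⇔; case_of_)
  open import Relation.Unary using (Decidable)
  open import Relation.Nullary using (yes; no)
  open import Relation.Binary.PropositionalEquality

  module _ {A B : Set} {P : A → Set} {Q : B → Set} (P? : Decidable P) (Q? : Decidable Q)
           {xs : List A} {ys : List B} (f : A → B) (g : B → A) where

    count-bijection : Unique xs → Unique ys →
      (∀ {x} → x ∈ xs → P x → f x ∈ ys × Q (f x) × g (f x) ≡ x) →
      (∀ {y} → y ∈ ys → Q y → g y ∈ xs × P (g y) × f (g y) ≡ y) →
      length (filter P? xs) ≡ length (filter Q? ys)
    count-bijection xs! ys! to from = begin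
        length (filter P? xs)          ≡⟨ sym (length-map f (filter P? xs)) ⟩
        length (map f (filter P? xs))  ≡⟨ ↭-length (∼bag⇒↭ (unique∧set⇒bag image! filter! same)) ⟩
        length (filter Q? ys)          ∎
      where
      open ≡-Reasoning
      filter! : Unique (filter Q? ys)
      filter! = Unique.filter⁺ Q? ys!
      retract : All (λ x → g (f x) ≡ x) (filter P? xs)
      retract = All.tabulate λ x∈ → let x∈xs , px = ∈-filter⁻ P? x∈ in proj₂ (proj₂ (to x∈xs px))
      image! : Unique (map f (filter P? xs))
      image! = Unique.map⁻ {f = g}
        (subst Unique (trans (sym (map-id-local retract)) (map-∘ (filter P? xs))) (Unique.filter⁺ P? xs!))
      same : ∀ {y} → (y ∈ map f (filter P? xs)) ⇔ (y ∈ filter Q? ys)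
      same = mk⇔ forth back
        where
        forth : ∀ {y} → y ∈ map f (filter P? xs) → y ∈ filter Q? ys
        forth y∈ with ∈-map⁻ f y∈
        ... | x , x∈ , refl = let x∈xs , px = ∈-filter⁻ P? x∈ ; fx∈ys , qfx , _ = to x∈xs px in
                              ∈-filter⁺ Q? fx∈ys qfx
        back : ∀ {y} → y ∈ filter Q? ys → y ∈ map f (filter P? xs)
        back {y} y∈ with ∈-filter⁻ Q? y∈
        ... | y∈ys , qy = let gy∈xs , pgy , fgy≡y = from y∈ys qy in
                          subst (_∈ _) fgy≡y (∈-map⁺ f (∈-filter⁺ P? gy∈xs pgy))

  length-filter-map : ∀ {A B : Set} {P : B → Set} (P? : Decidable P) (f : A → B) xs →
                      length (filter P? (map f xs)) ≡ length (filter (P? ∘ f) xs)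
  length-filter-map P? f []       = refl
  length-filter-map P? f (x ∷ xs) with P? (f x)
  ... | yes _ = cong suc (length-filter-map P? f xs)
  ... | no  _ = length-filter-map P? f xs

  concatMap-map≡cartesianProductWith : ∀ {A B C : Set} (f : A → B → C) xs ys →
    concatMap (λ x → map (f x) ys) xs ≡ cartesianProductWith f xs ys
  concatMap-map≡cartesianProductWith f []       ys = refl
  concatMap-map≡cartesianProductWith f (x ∷ xs) ys =
    cong (map (f x) ys ++_) (concatMap-map≡cartesianProductWith f xs ys)

  module _ {A : Set} (xs : List A) where

    vecsOver≡ : ∀ k → vecsOver xs (suc k) ≡ cartesianProductWith _∷ᵥ_ xs (vecsOver xs k)
    vecsOver≡ k = concatMap-map≡cartesianProductWith _∷ᵥ_ xs (vecsOver xs k)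

    ∈-vecsOver⁺ : ∀ {k} (v : Vec A k) → All (_∈ xs) (toList v) → v ∈ vecsOver xs k
    ∈-vecsOver⁺ []ᵥ       _         = here refl
    ∈-vecsOver⁺ (a ∷ᵥ v) (a∈ ∷ v∈) =
      subst (a ∷ᵥ v ∈_) (sym (vecsOver≡ _)) (∈-cartesianProductWith⁺ _∷ᵥ_ a∈ (∈-vecsOver⁺ v v∈))

    ∈-vecsOver⁻ : ∀ {k} (v : Vec A k) → v ∈ vecsOver xs k → All (_∈ xs) (toList v)
    ∈-vecsOver⁻ {zero}  []ᵥ _  = []
    ∈-vecsOver⁻ {suc k} v   v∈
      with ∈-cartesianProductWith⁻ _∷ᵥ_ xs (vecsOver xs k) (subst (v ∈_) (vecsOver≡ k) v∈)
    ... | a , v′ , a∈ , v′∈ , refl = a∈ ∷ ∈-vecsOver⁻ v′ v′∈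

    vecsOver-unique : Unique xs → ∀ k → Unique (vecsOver xs k)
    vecsOver-unique xs! zero    = [] ∷ []
    vecsOver-unique xs! (suc k) = subst Unique (sym (vecsOver≡ k))
      (Unique.cartesianProductWith⁺ _∷ᵥ_ Vec.∷-injective xs! (vecsOver-unique xs! k))

  segment : ℕ → ℕ → List ℕ
  segment o zero    = []
  segment o (suc k) = suc o ∷ segment (suc o) k

  ∈-segment⁻ : ∀ {v} o k → v ∈ segment o k → o < v × v ≤ o + k
  ∈-segment⁻ o (suc k) (here refl) = ≤-refl , ≤-trans (s≤s (m≤m+n o k)) (≤-reflexive (sym (+-suc o k)))
  ∈-segment⁻ o (suc k) (there v∈) with ∈-segment⁻ (suc o) k v∈
  ... | o+1<v , v≤ = <-trans (n<1+n o) o+1<v , ≤-trans v≤ (≤-reflexive (sym (+-suc o k)))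

  ∈-segment⁺ : ∀ {v} o k → o < v → v ≤ o + k → v ∈ segment o k
  ∈-segment⁺ o zero    o<v v≤o+0 =
    ⊥-elim (<-irrefl refl (<-≤-trans o<v (≤-trans v≤o+0 (≤-reflexive (+-identityʳ o)))))
  ∈-segment⁺ {v} o (suc k) o<v v≤ with m≤n⇒m<n∨m≡n o<v
  ... | inj₂ refl = here refl
  ... | inj₁ o+1<v = there (∈-segment⁺ (suc o) k o+1<v (≤-trans v≤ (≤-reflexive (+-suc o k))))

  sorted-≡ : ∀ {xs ys} → AllPairs _<_ xs → AllPairs _<_ ys →
             (∀ {u} → u ∈ xs → u ∈ ys) → (∀ {u} → u ∈ ys → u ∈ xs) → xs ≡ ys
  sorted-≡ {[]}    {[]}    _ _ _ _ = refl
  sorted-≡ {[]}    {y ∷ _} _ _ _ from = case from (here refl) of λ ()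
  sorted-≡ {x ∷ _} {[]}    _ _ to _   = case to (here refl) of λ ()
  sorted-≡ {x ∷ xs} {y ∷ ys} (x< ∷ xs↑) (y< ∷ ys↑) to from = cong₂ _∷_ x≡y (sorted-≡ xs↑ ys↑
      (λ u∈ → dropHead (subst (_< _) x≡y (All.lookup x< u∈)) (to (there u∈)))
      (λ u∈ → dropHead (subst (_< _) (sym x≡y) (All.lookup y< u∈)) (from (there u∈))))
    where
    headBound : ∀ {a b as} → All (a <_) as → b ∈ a ∷ as → a ≤ b
    headBound _  (here refl) = ≤-refl
    headBound a< (there b∈) = <⇒≤ (All.lookup a< b∈)
    x≡y : x ≡ y
    x≡y = ≤-antisym (headBound x< (from (here refl))) (headBound y< (to (here refl)))
    dropHead : ∀ {a u as} → a < u → u ∈ a ∷ as → u ∈ as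
    dropHead a<u (here refl) = ⊥-elim (<-irrefl refl a<u)
    dropHead _   (there u∈) = u∈

  segment-sorted : ∀ o k → AllPairs _<_ (segment o k)
  segment-sorted o zero    = []
  segment-sorted o (suc k) =
    All.tabulate (λ u∈ → proj₁ (∈-segment⁻ (suc o) k u∈)) ∷ segment-sorted (suc o) k

  ∈-oneTo⁺ : ∀ {v N} → 0 < v → v ≤ N → v ∈ oneTo N
  ∈-oneTo⁺ {suc i} _ i<N = ∈-applyUpTo⁺ suc i<N

  ∈-oneTo⁻ : ∀ {v N} → v ∈ oneTo N → 0 < v × v ≤ N
  ∈-oneTo⁻ {N = N} v∈ with ∈-applyUpTo⁻ suc {n = N} v∈
  ... | i , i<N , refl = s≤s z≤n , i<N

  oneTo-unique : ∀ N → Unique (oneTo N)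
  oneTo-unique N = Unique.applyUpTo⁺₁ suc N (λ i<j _ 1+i≡1+j → <-irrefl (suc-injective 1+i≡1+j) i<j)

  module _ (m n : ℕ) where

    private
      rows : List (Vec ℕ (m * n))
      rows = vecsOver (oneTo (2 * (m * n))) (m * n)

      allFillings≡ : allFillings m n ≡ cartesianProduct rows rows
      allFillings≡ = concatMap-map≡cartesianProductWith _,_ rows rows

    ∈-allFillings⁺ : ∀ {r₁ r₂} → All (_∈ oneTo (2 * (m * n))) (toList r₁) →
                     All (_∈ oneTo (2 * (m * n))) (toList r₂) → (r₁ , r₂) ∈ allFillings m n
    ∈-allFillings⁺ {r₁} {r₂} r₁∈ r₂∈ = subst ((r₁ , r₂) ∈_) (sym allFillings≡)
      (∈-cartesianProduct⁺ (∈-vecsOver⁺ _ r₁ r₁∈) (∈-vecsOver⁺ _ r₂ r₂∈))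

    ∈-allFillings⁻ : ∀ {r₁ r₂} → (r₁ , r₂) ∈ allFillings m n →
      All (_∈ oneTo (2 * (m * n))) (toList r₁) × All (_∈ oneTo (2 * (m * n))) (toList r₂)
    ∈-allFillings⁻ {r₁} {r₂} r∈
      with ∈-cartesianProduct⁻ rows rows (subst ((r₁ , r₂) ∈_) allFillings≡ r∈)
    ... | r₁∈ , r₂∈ = ∈-vecsOver⁻ _ r₁ r₁∈ , ∈-vecsOver⁻ _ r₂ r₂∈

    allFillings-unique : Unique (allFillings m n)
    allFillings-unique = subst Unique (sym allFillings≡) (Unique.cartesianProduct⁺ rows! rows!)
      where
      rows! : Unique rows
      rows! = vecsOver-unique _ (oneTo-unique _) (m * n)

module Walks where

  open import Defs using (Step; N; E; move; rep)
  open import Data.Nat using (ℕ; zero; suc; _+_; _≤_; _<_; z≤n; s≤s)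
  open import Data.Nat.Properties using (<-irrefl; <-≤-trans; +-suc; m≤n⇒m<n∨m≡n)
  open import Data.List using (List; []; _∷_; _++_; foldl; scanl)
  open import Data.List.Relation.Unary.All using (All; []; _∷_)
  open import Data.List.Relation.Unary.Any using (Any; here; there)
  open import Data.Product using (_×_; _,_; proj₁)
  open import Data.Sum using (inj₁; inj₂)
  open import Data.Unit using (⊤; tt)
  open import Data.Empty using (⊥-elim)
  open import Relation.Binary.PropositionalEquality

  Point : Set
  Point = ℕ × ℕ

  endFrom : Point → List Step → Point
  endFrom = foldl move

  module _ (P : Point → Set) where

    All-scanl-++⁺ : ∀ p w₁ w₂ → All P (scanl move p w₁) → All P (scanl move (endFrom p w₁) w₂) →
                    All P (scanl move p (w₁ ++ w₂))
    All-scanl-++⁺ p []       w₂ _           all₂ = all₂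
    All-scanl-++⁺ p (s ∷ w₁) w₂ (pp ∷ all₁) all₂ = pp ∷ All-scanl-++⁺ (move p s) w₁ w₂ all₁ all₂

    All-scanl-++⁻ : ∀ p w₁ w₂ → All P (scanl move p (w₁ ++ w₂)) →
                    All P (scanl move p w₁) × All P (scanl move (endFrom p w₁) w₂)
    All-scanl-++⁻ p []       w₂ all@(pp ∷ _) = pp ∷ [] , all
    All-scanl-++⁻ p (s ∷ w₁) w₂ (pp ∷ all) with All-scanl-++⁻ (move p s) w₁ w₂ all
    ... | all₁ , all₂ = pp ∷ all₁ , all₂

    All-scanl-last : ∀ p w → All P (scanl move p w) → P (endFrom p w)
    All-scanl-last p []      (pp ∷ []) = pp
    All-scanl-last p (s ∷ w) (_ ∷ all) = All-scanl-last (move p s) w all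

    All-east-run : ∀ k a c → (∀ i → i ≤ k → P (i + a , c)) → All P (scanl move (a , c) (rep k (E ∷ [])))
    All-east-run zero    a c h = h 0 z≤n ∷ []
    All-east-run (suc k) a c h = h 0 z≤n ∷ All-east-run k (suc a) c λ i i≤k →
      subst (λ z → P (z , c)) (sym (+-suc i a)) (h (suc i) (s≤s i≤k))

    All-north-run : ∀ k a c → (∀ i → i ≤ k → P (a , i + c)) → All P (scanl move (a , c) (rep k (N ∷ [])))
    All-north-run zero    a c h = h 0 z≤n ∷ []
    All-north-run (suc k) a c h = h 0 z≤n ∷ All-north-run k a (suc c) λ i i≤k →
      subst (λ z → P (a , z)) (sym (+-suc i c)) (h (suc i) (s≤s i≤k))

  module _ (T : Point → Set) where

    EastStepsEndIn : Point → List Step → Set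
    EastStepsEndIn p []      = ⊤
    EastStepsEndIn p (N ∷ w) = EastStepsEndIn (move p N) w
    EastStepsEndIn p (E ∷ w) = T (move p E) × EastStepsEndIn (move p E) w

    EastStepsEndIn-++ : ∀ p w₁ w₂ → EastStepsEndIn p w₁ → EastStepsEndIn (endFrom p w₁) w₂ →
                        EastStepsEndIn p (w₁ ++ w₂)
    EastStepsEndIn-++ p []       w₂ _        e₂ = e₂
    EastStepsEndIn-++ p (N ∷ w₁) w₂ e₁       e₂ = EastStepsEndIn-++ (move p N) w₁ w₂ e₁ e₂
    EastStepsEndIn-++ p (E ∷ w₁) w₂ (t , e₁) e₂ = t , EastStepsEndIn-++ (move p E) w₁ w₂ e₁ e₂

    east-run-endsIn : ∀ k a c → (∀ i → i < k → T (suc i + a , c)) → EastStepsEndIn (a , c) (rep k (E ∷ []))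
    east-run-endsIn zero    a c h = tt
    east-run-endsIn (suc k) a c h = h 0 (s≤s z≤n) , east-run-endsIn k (suc a) c λ i i<k →
      subst (λ z → T (z , c)) (sym (cong suc (+-suc i a))) (h (suc i) (s≤s i<k))

    north-run-endsIn : ∀ k p → EastStepsEndIn p (rep k (N ∷ []))
    north-run-endsIn zero    p = tt
    north-run-endsIn (suc k) p = north-run-endsIn k (move p N)

    visits-column : ∀ p w → EastStepsEndIn p w → ∀ x → proj₁ p < x → x ≤ proj₁ (endFrom p w) →
                    Any (λ q → proj₁ q ≡ x × T q) (scanl move p w)
    visits-column p       []      _       x p<x x≤end = ⊥-elim (<-irrefl refl (<-≤-trans p<x x≤end))
    visits-column p       (N ∷ w) e       x p<x x≤end = there (visits-column (move p N) w e x p<x x≤end)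
    visits-column (a , c) (E ∷ w) (t , e) x a<x x≤end with m≤n⇒m<n∨m≡n a<x
    ... | inj₁ a+1<x = there (visits-column (suc a , c) w e x a+1<x x≤end)
    ... | inj₂ refl  = there (entered w)
      where
      entered : ∀ w → Any (λ q → proj₁ q ≡ suc a × T q) (scanl move (suc a , c) w)
      entered []      = here (refl , t)
      entered (_ ∷ _) = here (refl , t)

  endFrom-east-run : ∀ k a c → endFrom (a , c) (rep k (E ∷ [])) ≡ (k + a , c)
  endFrom-east-run zero    a c = refl
  endFrom-east-run (suc k) a c = trans (endFrom-east-run k (suc a) c) (cong (_, c) (+-suc k a))

  endFrom-north-run : ∀ k a c → endFrom (a , c) (rep k (N ∷ [])) ≡ (a , k + c)
  endFrom-north-run zero    a c = refl
  endFrom-north-run (suc k) a c = trans (endFrom-north-run k a (suc c)) (cong (a ,_) (+-suc k c))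

module Words where

  open import Defs using (Step; N; E; step-dec; occurrences)
  open Walks using (endFrom)
  open Enumeration using (segment; ∈-segment⁻; ∈-segment⁺; sorted-≡; segment-sorted)
  open import Data.Bool using (if_then_else_)
  open import Data.Nat
  open import Data.Nat.Properties
  open import Data.Fin using (Fin; zero; suc; toℕ)
  open import Data.List using (List; []; _∷_; _++_; map; filter; length)
  open import Data.List.Properties using (filter-accept; filter-reject; filter-none; filter-some; filter-++; length-++)
  open import Data.List.Relation.Unary.All as All using (All; []; _∷_)
  open import Data.List.Relation.Unary.All.Properties using (¬Any⇒All¬)
  open import Data.List.Relation.Unary.AllPairs using (AllPairs; []; _∷_)
  import Data.List.Relation.Unary.AllPairs.Properties as AllPairs
  open import Data.List.Relation.Unary.Any using (here; there)
  open import Data.List.Membership.Propositional using (_∈_)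
  open import Data.List.Membership.Propositional.Properties using (∈-filter⁺; ∈-filter⁻)
  open import Data.List.Membership.DecPropositional _≟_ using (_∈?_)
  open import Data.Vec using (Vec; toList; lookup) renaming ([] to []ᵥ; _∷_ to _∷ᵥ_)
  open import Data.Product using (_×_; _,_; proj₁)
  open import Data.Empty using (⊥-elim)
  open import Function using (_∘_; id; _⇔_; mk⇔; module Equivalence)
  open import Function.Construct.Composition using (_⇔-∘_)
  open import Relation.Unary using (Decidable)
  open import Relation.Nullary using (¬_; ¬?; yes; no; does)
  open import Relation.Binary.PropositionalEquality

  positions : Step → ℕ → List Step → List ℕ
  positions s o []       = []
  positions s o (s′ ∷ w) =
    if does (step-dec s′ s) then suc o ∷ positions s (suc o) w else positions s (suc o) w

  private
    shiftBounds : ∀ {o k v} → suc o < v × v ≤ suc o + k → o < v × v ≤ o + suc k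
    shiftBounds {o} (o+1<v , v≤) = <-trans (n<1+n o) o+1<v , ≤-trans v≤ (≤-reflexive (sym (+-suc o _)))

    1+o≤o+1+k : ∀ o k → suc o ≤ o + suc k
    1+o≤o+1+k o k = ≤-trans (s≤s (m≤m+n o k)) (≤-reflexive (sym (+-suc o k)))

  positions-range : ∀ s o w {v} → v ∈ positions s o w → o < v × v ≤ o + length w
  positions-range s o (s′ ∷ w) v∈ with step-dec s′ s | v∈
  ... | yes _ | here refl = ≤-refl , 1+o≤o+1+k o _
  ... | yes _ | there v∈′ = shiftBounds (positions-range s (suc o) w v∈′)
  ... | no  _ | v∈′       = shiftBounds (positions-range s (suc o) w v∈′)

  positions-sorted : ∀ s o w → AllPairs _<_ (positions s o w)
  positions-sorted s o []       = []
  positions-sorted s o (s′ ∷ w) with step-dec s′ s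
  ... | yes _ = All.tabulate (proj₁ ∘ positions-range s (suc o) w) ∷ positions-sorted s (suc o) w
  ... | no  _ = positions-sorted s (suc o) w

  positions-++ : ∀ s o w₁ w₂ →
                 positions s o (w₁ ++ w₂) ≡ positions s o w₁ ++ positions s (o + length w₁) w₂
  positions-++ s o []        w₂ = cong (λ o → positions s o w₂) (sym (+-identityʳ o))
  positions-++ s o (s′ ∷ w₁) w₂ with step-dec s′ s
  ... | yes _ = cong (suc o ∷_) shifted
    where
    shifted = trans (positions-++ s (suc o) w₁ w₂)
                    (cong (λ o′ → positions s (suc o) w₁ ++ positions s o′ w₂) (sym (+-suc o _)))
  ... | no  _ = trans (positions-++ s (suc o) w₁ w₂)
                      (cong (λ o′ → positions s (suc o) w₁ ++ positions s o′ w₂) (sym (+-suc o _)))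

  ∈-positions-∷ : ∀ t s o w {u} → suc o < u →
                  (u ∈ positions t o (s ∷ w)) ⇔ (u ∈ positions t (suc o) w)
  ∈-positions-∷ t s o w o+1<u with step-dec s t
  ... | yes _ = mk⇔ (λ { (here refl) → ⊥-elim (<-irrefl refl o+1<u) ; (there u∈) → u∈ }) there
  ... | no  _ = mk⇔ id id

  endFrom-positions : ∀ o w a c →
                      endFrom (a , c) w ≡ (length (positions E o w) + a , length (positions N o w) + c)
  endFrom-positions o []      a c = refl
  endFrom-positions o (N ∷ w) a c = trans (endFrom-positions (suc o) w a (suc c))
                                          (cong (length (positions E (suc o) w) + a ,_) (+-suc _ c))
  endFrom-positions o (E ∷ w) a c = trans (endFrom-positions (suc o) w (suc a) c)
                                          (cong (_, length (positions N (suc o) w) + c) (+-suc _ a))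

  occurrences-∉ : ∀ {v xs} → ¬ v ∈ xs → occurrences v xs ≡ 0
  occurrences-∉ {v} v∉ = cong length (filter-none (v ≟_) (¬Any⇒All¬ _ v∉))

  occurrences-∈ : ∀ {v xs} → v ∈ xs → 0 < occurrences v xs
  occurrences-∈ {v} = filter-some (v ≟_)

  ∈-occurrences : ∀ {v xs} → 0 < occurrences v xs → v ∈ xs
  ∈-occurrences {v} {xs} 0<occ with v ∈? xs
  ... | yes v∈ = v∈
  ... | no  v∉ = ⊥-elim (<-irrefl (sym (occurrences-∉ v∉)) 0<occ)

  occurrences-++ : ∀ v xs ys → occurrences v (xs ++ ys) ≡ occurrences v xs + occurrences v ys
  occurrences-++ v xs ys = trans (cong length (filter-++ (v ≟_) xs ys)) (length-++ (filter (v ≟_) xs))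

  occurrences-once⇒partition : ∀ {v} xs ys → occurrences v (xs ++ ys) ≡ 1 → (v ∈ ys) ⇔ (¬ v ∈ xs)
  occurrences-once⇒partition {v} xs ys once = mk⇔
    (λ v∈ys v∈xs → <-irrefl (sym once)
       (subst (2 ≤_) (sym (occurrences-++ v xs ys)) (+-mono-≤ (occurrences-∈ v∈xs) (occurrences-∈ v∈ys))))
    (λ v∉xs → ∈-occurrences (≤-reflexive (sym
      (trans (cong (_+ occurrences v ys) (sym (occurrences-∉ v∉xs))) (trans (sym (occurrences-++ v xs ys)) once)))))

  occurrences-positions : ∀ o w {v} → o < v → v ≤ o + length w →
                          occurrences v (positions N o w) + occurrences v (positions E o w) ≡ 1
  occurrences-positions o []      o<v v≤o+0 =
    ⊥-elim (<-irrefl refl (<-≤-trans o<v (≤-trans v≤o+0 (≤-reflexive (+-identityʳ o)))))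
  occurrences-positions o (s ∷ w) {v} o<v v≤ with v ≟ suc o
  ... | yes refl = atHead s
    where
    miss : ∀ s → occurrences (suc o) (positions s (suc o) w) ≡ 0
    miss s = occurrences-∉ (λ v∈ → <-irrefl refl (proj₁ (positions-range s (suc o) w v∈)))
    hit : ∀ s → occurrences (suc o) (suc o ∷ positions s (suc o) w) ≡ 1
    hit s = trans (cong length (filter-accept (suc o ≟_) refl)) (cong suc (miss s))
    atHead : ∀ s →
             occurrences (suc o) (positions N o (s ∷ w)) + occurrences (suc o) (positions E o (s ∷ w)) ≡ 1
    atHead N = cong₂ _+_ (hit N) (miss E)
    atHead E = cong₂ _+_ (miss N) (hit E)
  ... | no v≢1+o = later s
    where
    rest : occurrences v (positions N (suc o) w) + occurrences v (positions E (suc o) w) ≡ 1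
    rest = occurrences-positions (suc o) w (≤∧≢⇒< o<v (v≢1+o ∘ sym))
                                           (≤-trans v≤ (≤-reflexive (+-suc o _)))
    skip : ∀ xs → occurrences v (suc o ∷ xs) ≡ occurrences v xs
    skip xs = cong length (filter-reject (v ≟_) v≢1+o)
    later : ∀ s → occurrences v (positions N o (s ∷ w)) + occurrences v (positions E o (s ∷ w)) ≡ 1
    later N = trans (cong (_+ occurrences v (positions E (suc o) w)) (skip _)) rest
    later E = trans (cong (occurrences v (positions N (suc o) w) +_) (skip _)) rest

  stepsAt : (ℕ → Step) → ℕ → (k : ℕ) → Vec Step k
  stepsAt h o zero    = []ᵥ
  stepsAt h o (suc k) = h (suc o) ∷ᵥ stepsAt h (suc o) k

  toList-stepsAt : ∀ h o k → toList (stepsAt h o k) ≡ map h (segment o k)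
  toList-stepsAt h o zero    = refl
  toList-stepsAt h o (suc k) = cong (h (suc o) ∷_) (toList-stepsAt h (suc o) k)

  module _ {D : ℕ → Set} (D? : Decidable D) where

    indicator : ℕ → Step
    indicator v = if does (D? v) then N else E

    positions-indicatorᴺ : ∀ o k → positions N o (map indicator (segment o k)) ≡ filter D? (segment o k)
    positions-indicatorᴺ o zero    = refl
    positions-indicatorᴺ o (suc k) with D? (suc o)
    ... | yes _ = cong (suc o ∷_) (positions-indicatorᴺ (suc o) k)
    ... | no  _ = positions-indicatorᴺ (suc o) k

    positions-indicatorᴱ : ∀ o k →
                           positions E o (map indicator (segment o k)) ≡ filter (¬? ∘ D?) (segment o k)
    positions-indicatorᴱ o zero    = refl
    positions-indicatorᴱ o (suc k) with D? (suc o)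
    ... | yes _ = positions-indicatorᴱ (suc o) k
    ... | no  _ = cong (suc o ∷_) (positions-indicatorᴱ (suc o) k)

    filter-segment : ∀ o k {xs} → AllPairs _<_ xs → (∀ {u} → (u ∈ xs) ⇔ (D u × o < u × u ≤ o + k)) →
                     filter D? (segment o k) ≡ xs
    filter-segment o k xs↑ ∈xs⇔ = sorted-≡ (AllPairs.filter⁺ D? (segment-sorted o k)) xs↑
      (λ u∈ → let u∈seg , d = ∈-filter⁻ D? u∈ ; o<u , u≤ = ∈-segment⁻ o k u∈seg in
              Equivalence.from ∈xs⇔ (d , o<u , u≤))
      (λ u∈ → let d , o<u , u≤ = Equivalence.to ∈xs⇔ u∈ in ∈-filter⁺ D? (∈-segment⁺ o k o<u u≤) d)

    map-indicator-positions : ∀ o w →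
                              (∀ {u} → o < u → u ≤ o + length w → D u ⇔ (u ∈ positions N o w)) →
                              map indicator (segment o (length w)) ≡ w
    map-indicator-positions o []      _  = refl
    map-indicator-positions o (s ∷ w) D⇔ = cong₂ _∷_ (first s D⇔) (map-indicator-positions (suc o) w later)
      where
      fresh : ¬ suc o ∈ positions N (suc o) w
      fresh 1+o∈ = <-irrefl refl (proj₁ (positions-range N (suc o) w 1+o∈))
      first : ∀ s → (∀ {u} → o < u → u ≤ o + suc (length w) → D u ⇔ (u ∈ positions N o (s ∷ w))) →
              indicator (suc o) ≡ s
      first s D⇔ with D? (suc o) | s
      ... | yes _ | N = refl
      ... | yes d | E = ⊥-elim (fresh (Equivalence.to (D⇔ ≤-refl (1+o≤o+1+k o _)) d))
      ... | no ¬d | N = ⊥-elim (¬d (Equivalence.from (D⇔ ≤-refl (1+o≤o+1+k o _)) (here refl)))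
      ... | no  _ | E = refl
      later : ∀ {u} → suc o < u → u ≤ suc o + length w → D u ⇔ (u ∈ positions N (suc o) w)
      later o+1<u u≤ = ∈-positions-∷ N s o w o+1<u ⇔-∘
                       D⇔ (<-trans (n<1+n o) o+1<u) (≤-trans u≤ (≤-reflexive (sym (+-suc o _))))

  -- nth and pad are only used on lists of known length, so their default entry 0 is never read.
  nth : List ℕ → ℕ → ℕ
  nth []       _       = 0
  nth (x ∷ xs) zero    = x
  nth (x ∷ xs) (suc i) = nth xs i

  nth-++ˡ : ∀ xs ys {c} → c < length xs → nth (xs ++ ys) c ≡ nth xs c
  nth-++ˡ (x ∷ xs) ys {zero}  _           = refl
  nth-++ˡ (x ∷ xs) ys {suc c} (s≤s c<len) = nth-++ˡ xs ys c<len

  nth-∷ʳ : ∀ xs v → nth (xs ++ v ∷ []) (length xs) ≡ v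
  nth-∷ʳ []       v = refl
  nth-∷ʳ (x ∷ xs) v = nth-∷ʳ xs v

  nth-∈ : ∀ xs {c} → c < length xs → nth xs c ∈ xs
  nth-∈ (x ∷ xs) {zero}  _           = here refl
  nth-∈ (x ∷ xs) {suc c} (s≤s c<len) = there (nth-∈ xs c<len)

  pad : (k : ℕ) → List ℕ → Vec ℕ k
  pad zero    _        = []ᵥ
  pad (suc k) []       = 0 ∷ᵥ pad k []
  pad (suc k) (x ∷ xs) = x ∷ᵥ pad k xs

  toList-pad : ∀ k xs → length xs ≡ k → toList (pad k xs) ≡ xs
  toList-pad zero    []       _   = refl
  toList-pad (suc k) (x ∷ xs) len = cong (x ∷_) (toList-pad k xs (suc-injective len))

  pad-toList : ∀ {k} (v : Vec ℕ k) → pad k (toList v) ≡ v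
  pad-toList []ᵥ       = refl
  pad-toList (x ∷ᵥ v) = cong (x ∷ᵥ_) (pad-toList v)

  lookup-pad : ∀ k xs (i : Fin k) → lookup (pad k xs) i ≡ nth xs (toℕ i)
  lookup-pad (suc k) []       zero    = refl
  lookup-pad (suc k) []       (suc i) = lookup-pad k [] i
  lookup-pad (suc k) (x ∷ xs) zero    = refl
  lookup-pad (suc k) (x ∷ xs) (suc i) = lookup-pad k xs i

module Staircase (m′ n′ : ℕ) where

  open import Defs using (aSeq; IsWall)
  open import Data.Nat
  open import Data.Nat.Properties
  open import Data.Nat.DivMod
  open import Data.Fin using (toℕ; fromℕ<)
  open import Data.Fin.Properties using (toℕ-fromℕ<; toℕ<n)
  open import Data.Product using (_×_; _,_; proj₁)
  open import Relation.Binary.PropositionalEquality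
  open import Relation.Nullary using (¬_; yes; no)
  open import Relation.Nullary.Decidable using (dec-true; dec-false)
  open import Relation.Nullary.Negation using (contradiction)

  m n L : ℕ
  m = suc m′
  n = suc n′
  L = m * n

  -- The boundary path N (E^m N^m)^(n-1) E^m N^(m-1) crosses columns jm + 1, …, jm + m at height jm + 1, so
  -- floorAt x is the lowest height it reaches over column x, and Above is the region weakly above it.
  floorAt : ℕ → ℕ
  floorAt zero    = 0
  floorAt (suc x) = suc (x / m * m)

  Above : ℕ → ℕ → Set
  Above x y = x ≤ L × floorAt x ≤ y

  b : ℕ → ℕ
  b t = aSeq m n (suc t)

  floorAt≤ : ∀ x → floorAt x ≤ x
  floorAt≤ zero    = z≤n
  floorAt≤ (suc x) = s≤s (m/n*n≤m x m)

  private
    <-/-mono : ∀ x q → x / m ≤ q → x < suc q * m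
    <-/-mono x q x/m≤q = begin-strict
        x                  ≡⟨ m≡m%n+[m/n]*n x m ⟩
        x % m + x / m * m  <⟨ +-monoˡ-< (x / m * m) (m%n<n x m) ⟩
        m + x / m * m      ≤⟨ +-monoʳ-≤ m (*-monoˡ-≤ m x/m≤q) ⟩
        m + q * m          ∎
      where open ≤-Reasoning

    /-<-mono : ∀ x q → x < suc q * m → x / m ≤ q
    /-<-mono x q x<[1+q]m = ≤-pred (m<n*o⇒m/o<n {x} {suc q} {m} x<[1+q]m)

    ≤-/-mono : ∀ x q → q * m ≤ x → q ≤ x / m
    ≤-/-mono x q qm≤x = subst (_≤ x / m) (m*n/n≡m q m) (/-monoˡ-≤ m qm≤x)

    ⌈1+y/m⌉ : ∀ y → (suc y + m′) / m ≡ suc (y / m)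
    ⌈1+y/m⌉ y = trans (/-congˡ {o = m} (sym (+-suc y m′)))
      (trans (m/n≡1+[m∸n]/n {y + m} {m} (m≤n+m m y)) (cong (λ z → suc (z / m)) (m+n∸n≡m y m)))

    b-low : ∀ y → suc y ≤ n′ * m → b y ≡ suc (y / m) * m
    b-low y 1+y≤n′m rewrite dec-true (suc y ≤? n′ * m) 1+y≤n′m = cong (_* m) (⌈1+y/m⌉ y)

    b-high : ∀ y → ¬ (suc y ≤ n′ * m) → b y ≡ L
    b-high y 1+y≰n′m rewrite dec-false (suc y ≤? n′ * m) 1+y≰n′m = refl

    n′m≤L : n′ * m ≤ L
    n′m≤L = subst (n′ * m ≤_) (*-comm n m) (*-monoˡ-≤ m (n≤1+n n′))

    floorAt≤1+⇒ : ∀ x t → floorAt (suc x) ≤ suc t → suc x ≤ suc (t / m) * m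
    floorAt≤1+⇒ x t (s≤s [x/m]m≤t) = <-/-mono x (t / m) (≤-/-mono t (x / m) [x/m]m≤t)

    floorAt≤1+⇐ : ∀ x t → suc x ≤ suc (t / m) * m → floorAt (suc x) ≤ suc t
    floorAt≤1+⇐ x t 1+x≤ = s≤s (≤-trans (*-monoˡ-≤ m (/-<-mono x (t / m) 1+x≤)) (m/n*n≤m t m))

  ≤b⇒Above : ∀ x t → x ≤ b t → Above x (suc t)
  ≤b⇒Above x t x≤b with suc t ≤? n′ * m
  ... | yes low = ≤-trans x≤ (≤-trans (*-monoˡ-≤ m (m<n*o⇒m/o<n {t} {n′} {m} low)) n′m≤L) ,
                  floor x x≤
    where
    x≤ : x ≤ suc (t / m) * m
    x≤ = subst (x ≤_) (b-low t low) x≤b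
    floor : ∀ x → x ≤ suc (t / m) * m → floorAt x ≤ suc t
    floor zero    _  = z≤n
    floor (suc x) x≤ = floorAt≤1+⇐ x t x≤
  ... | no high = x≤L , floor x x≤L
    where
    x≤L : x ≤ L
    x≤L = subst (x ≤_) (b-high t high) x≤b
    floor : ∀ x → x ≤ L → floorAt x ≤ suc t
    floor zero    _   = z≤n
    floor (suc x) 1+x≤L =
      s≤s (≤-trans (*-monoˡ-≤ m (/-<-mono x n′ (subst (x <_) (*-comm m n) 1+x≤L))) (≤-pred (≰⇒> high)))

  Above⇒≤b : ∀ x t → Above x (suc t) → x ≤ b t
  Above⇒≤b zero    t _ = z≤n
  Above⇒≤b (suc x) t (x≤L , floor≤) with suc t ≤? n′ * m
  ... | yes low = subst (suc x ≤_) (sym (b-low t low)) (floorAt≤1+⇒ x t floor≤)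
  ... | no high = subst (suc x ≤_) (sym (b-high t high)) x≤L

  b-mono : ∀ {t t′} → t ≤ t′ → b t ≤ b t′
  b-mono {t} {t′} t≤t′ with ≤b⇒Above (b t) t ≤-refl
  ... | b≤L , floor≤ = Above⇒≤b (b t) t′ (b≤L , ≤-trans floor≤ (s≤s t≤t′))

  b≤L : ∀ t → b t ≤ L
  b≤L t = proj₁ (≤b⇒Above (b t) t ≤-refl)

  private
    [qm+r]/m≡q : ∀ q r → r < m → (q * m + r) / m ≡ q
    [qm+r]/m≡q q r r<m = begin
        (q * m + r) / m    ≡⟨ +-distrib-/ (q * m) r
                                (subst₂ (λ a c → a + c < m) (sym (m*n%n≡0 q m)) (sym (m<n⇒m%n≡m r<m)) r<m) ⟩
        q * m / m + r / m  ≡⟨ cong₂ _+_ (m*n/n≡m q m) (m<n⇒m/n≡0 r<m) ⟩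
        q + 0              ≡⟨ +-identityʳ q ⟩
        q                  ∎
      where open ≡-Reasoning

  floorAt-block : ∀ j i → i < m → floorAt (suc (i + j * m)) ≡ suc (j * m)
  floorAt-block j i i<m =
    cong (λ z → suc (z * m)) (trans (cong (_/ m) (+-comm i (j * m))) ([qm+r]/m≡q j i i<m))

  floorAt-wall : ∀ x → IsWall m n (suc x) → floorAt (suc x) ≡ floorAt x
  floorAt-wall x (j , i , 2≤i , 1+x≡jm+i) = sameBlock (toℕ i) 2≤i (toℕ<n i) 1+x≡jm+i
    where
    sameBlock : ∀ I → 2 ≤ I → I < suc m → suc x ≡ toℕ j * m + I → floorAt (suc x) ≡ floorAt x
    sameBlock (suc (suc r)) (s≤s (s≤s z≤n)) (s≤s r+2≤m) eq =
      subst (λ x → floorAt (suc x) ≡ floorAt x) (sym x≡)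
        (trans (floorAt-block (toℕ j) (suc r) r+2≤m)
               (sym (floorAt-block (toℕ j) r (≤-trans (n≤1+n _) r+2≤m))))
      where
      x≡ : x ≡ suc (r + toℕ j * m)
      x≡ = suc-injective (trans eq (+-comm (toℕ j * m) (suc (suc r))))

  floorAt-nonWall : ∀ x → suc x ≤ L → ¬ IsWall m n (suc x) → floorAt (suc x) ≡ suc x
  floorAt-nonWall x 1+x≤L nonWall with x % m in x%m≡
  ... | zero   = cong suc (sym (trans (m≡m%n+[m/n]*n x m) (cong (_+ x / m * m) x%m≡)))
  ... | suc r = contradiction wall nonWall
    where
    q<n : x / m < n
    q<n = m<n*o⇒m/o<n {x} {n} {m} (subst (x <_) (*-comm m n) 1+x≤L)
    r<m : suc r < m
    r<m = subst (_< m) x%m≡ (m%n<n x m)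
    wall : IsWall m n (suc x)
    wall = fromℕ< q<n , fromℕ< {suc (suc r)} (s≤s r<m) , s≤s (s≤s z≤n) , (begin
        suc x                              ≡⟨ cong suc (m≡m%n+[m/n]*n x m) ⟩
        suc (x % m + x / m * m)            ≡⟨ cong (λ z → suc (z + x / m * m)) x%m≡ ⟩
        suc (suc r + x / m * m)            ≡⟨ cong suc (+-comm (suc r) _) ⟩
        suc (x / m * m + suc r)            ≡⟨ sym (+-suc _ (suc r)) ⟩
        x / m * m + suc (suc r)            ≡⟨ cong₂ (λ a c → a * m + c) (sym (toℕ-fromℕ< q<n))
                                                                          (sym (toℕ-fromℕ< (s≤s r<m))) ⟩
        toℕ (fromℕ< q<n) * m + toℕ (fromℕ< {suc (suc r)} (s≤s r<m)) ∎)
      where open ≡-Reasoning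

module Boundary (m′ n′ : ℕ) where

  open import Defs using (Step; N; E; move; rep; points; boundary; IsGoodPath)
  open Staircase m′ n′
  open Walks
  open import Data.Nat
  open import Data.Nat.Properties
  open import Data.List using (List; []; _∷_; _++_; scanl)
  open import Data.List.Properties using (foldl-++; ++-assoc)
  open import Data.List.Relation.Unary.All as All using (All; []; _∷_)
  open import Data.List.Relation.Unary.Any as Any using (Any; here)
  open import Data.List.Membership.Propositional using (find)
  open import Data.Product using (_×_; _,_; proj₁; proj₂)
  open import Relation.Binary.PropositionalEquality
  open import Data.Vec using (toList)
  open import Function using (_⇔_; mk⇔)

  AbovePoint : Point → Set
  AbovePoint (x , y) = Above x y

  OnFloor : Point → Set
  OnFloor (x , y) = y ≤ floorAt x

  NotBelow : Point → Set
  NotBelow p = Any (λ q → proj₁ q ≡ proj₁ p × proj₂ q ≤ proj₂ p) (points (boundary m n))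

  private
    block final : List Step
    block = rep m (E ∷ []) ++ rep m (N ∷ [])
    final = rep m (E ∷ []) ++ rep m′ (N ∷ [])

    start : ℕ → Point
    start j = j * m , suc (j * m)

    [1+j]m≤L : ∀ j → j < n → m + j * m ≤ L
    [1+j]m≤L j j<n = subst (m + j * m ≤_) (*-comm n m) (*-monoˡ-≤ m j<n)

    east-run-above : ∀ j → j < n → ∀ i → i ≤ m → AbovePoint (i + j * m , suc (j * m))
    east-run-above j j<n i i≤m = ≤-trans (+-monoˡ-≤ (j * m) i≤m) ([1+j]m≤L j j<n) , floor i i≤m
      where
      floor : ∀ i → i ≤ m → floorAt (i + j * m) ≤ suc (j * m)
      floor zero    _   = ≤-trans (floorAt≤ (j * m)) (n≤1+n _)
      floor (suc i) i<m = ≤-reflexive (floorAt-block j i i<m)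

    north-run-above : ∀ j → j < n → ∀ i → AbovePoint (m + j * m , i + suc (j * m))
    north-run-above j j<n i =
      [1+j]m≤L j j<n , ≤-trans (≤-reflexive (floorAt-block j m′ ≤-refl)) (m≤n+m _ i)

    endFrom-run : ∀ k j →
                  endFrom (start j) (rep m (E ∷ []) ++ rep k (N ∷ [])) ≡ (m + j * m , k + suc (j * m))
    endFrom-run k j = trans (foldl-++ move (start j) (rep m (E ∷ [])) (rep k (N ∷ [])))
      (trans (cong (λ p → endFrom p (rep k (N ∷ []))) (endFrom-east-run m (j * m) (suc (j * m))))
        (endFrom-north-run k (m + j * m) (suc (j * m))))

    run-above : ∀ k j → k ≤ m → j < n →
                All AbovePoint (scanl move (start j) (rep m (E ∷ []) ++ rep k (N ∷ [])))
    run-above k j k≤m j<n = All-scanl-++⁺ AbovePoint _ (rep m (E ∷ [])) (rep k (N ∷ []))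
      (All-east-run AbovePoint m (j * m) (suc (j * m)) (east-run-above j j<n))
      (subst (λ p → All AbovePoint (scanl move p (rep k (N ∷ []))))
             (sym (endFrom-east-run m (j * m) (suc (j * m))))
        (All-north-run AbovePoint k (m + j * m) (suc (j * m)) (λ i _ → north-run-above j j<n i)))

    run-onFloor : ∀ k j → EastStepsEndIn OnFloor (start j) (rep m (E ∷ []) ++ rep k (N ∷ []))
    run-onFloor k j = EastStepsEndIn-++ OnFloor _ (rep m (E ∷ [])) (rep k (N ∷ []))
      (east-run-endsIn OnFloor m (j * m) (suc (j * m)) (λ i i<m → ≤-reflexive (sym (floorAt-block j i i<m))))
      (north-run-endsIn OnFloor k _)

    Traced : ℕ → List Step → Set
    Traced j w = All AbovePoint (scanl move (start j) w) × EastStepsEndIn OnFloor (start j) w ×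
                 endFrom (start j) w ≡ (L , L)

    traced : ∀ k j → j + k ≡ n′ → Traced j (rep k block ++ final)
    traced zero j j+0≡n′ = run-above m′ j (n≤1+n m′) (s≤s (≤-reflexive j≡n′)) , run-onFloor m′ j ,
      trans (endFrom-run m′ j) (cong₂ _,_ [1+j]m≡L (trans (+-suc m′ (j * m)) [1+j]m≡L))
      where
      j≡n′ : j ≡ n′
      j≡n′ = trans (sym (+-identityʳ j)) j+0≡n′
      [1+j]m≡L : m + j * m ≡ L
      [1+j]m≡L = trans (cong (λ z → m + z * m) j≡n′) (*-comm n m)
    traced (suc k) j j+1+k≡n′ with traced k (suc j) (trans (sym (+-suc j k)) j+1+k≡n′)
    ... | above , onFloor , end = subst (Traced j) (sym (++-assoc block (rep k block) final))
      ( All-scanl-++⁺ AbovePoint _ block rest (run-above m j ≤-refl j<n)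
          (subst (λ p → All AbovePoint (scanl move p rest)) (sym endFrom-block) above)
      , EastStepsEndIn-++ OnFloor _ block rest (run-onFloor m j)
          (subst (λ p → EastStepsEndIn OnFloor p rest) (sym endFrom-block) onFloor)
      , trans (foldl-++ move _ block rest) (trans (cong (λ p → endFrom p rest) endFrom-block) end))
      where
      rest : List Step
      rest = rep k block ++ final
      j<n : j < n
      j<n = s≤s (subst (j ≤_) j+1+k≡n′ (m≤m+n j (suc k)))
      endFrom-block : endFrom (start j) block ≡ start (suc j)
      endFrom-block = trans (endFrom-run m j) (cong (m + j * m ,_) (+-suc m (j * m)))

    boundary-above : All AbovePoint (points (boundary m n))
    boundary-above = (z≤n , z≤n) ∷ proj₁ (traced n′ 0 refl)

    boundary-onFloor : EastStepsEndIn OnFloor (0 , 0) (boundary m n)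
    boundary-onFloor = proj₁ (proj₂ (traced n′ 0 refl))

    boundary-end : endFrom (0 , 0) (boundary m n) ≡ (L , L)
    boundary-end = proj₂ (proj₂ (traced n′ 0 refl))

  -- The boundary stays in Above, and each of its east steps ends on the floor; the latter means that every
  -- column 1, …, L contains a boundary point at height floorAt.
  NotBelow⇒Above : ∀ {x y} → NotBelow (x , y) → Above x y
  NotBelow⇒Above nb with find nb
  ... | q , q∈ , refl , qy≤y with All.lookup boundary-above q∈
  ...   | qx≤L , floor≤qy = qx≤L , ≤-trans floor≤qy qy≤y

  Above⇒NotBelow : ∀ {x y} → Above x y → NotBelow (x , y)
  Above⇒NotBelow {zero}  _                = here (refl , z≤n)
  Above⇒NotBelow {suc x} (1+x≤L , floor≤y) =
    Any.map (λ { (refl , onFloor) → refl , ≤-trans onFloor floor≤y })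
      (visits-column OnFloor (0 , 0) (boundary m n) boundary-onFloor (suc x) (s≤s z≤n)
        (subst (λ p → suc x ≤ proj₁ p) (sym boundary-end) 1+x≤L))

  AllAbove : List Step → Set
  AllAbove w = All AbovePoint (points w)

  IsGoodPath⇔ : ∀ w → IsGoodPath m n w ⇔ (endFrom (0 , 0) (toList w) ≡ (L , L) × AllAbove (toList w))
  IsGoodPath⇔ w = mk⇔ (λ (end , notBelow) → end , All.map NotBelow⇒Above notBelow)
                      (λ (end , above) → end , All.map Above⇒NotBelow above)

module GoodPaths (m′ n′ : ℕ) where

  open import Defs using (Step; N; E; move; vecsOver; numPaths; isGoodPath?)
  open Staircase m′ n′
  open Boundary m′ n′
  open Walks
  open Enumeration using (length-filter-map)
  open BoundedPaths using (paths; paths-split; paths-beyond)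
  open import Data.Nat
  open import Data.Nat.Properties
  open import Data.List using (List; []; _∷_; _++_; map; filter; length; scanl)
  open import Data.List.Properties
    using (filter-++; length-++; filter-≐; filter-none; filter-accept; ++-identityʳ)
  open import Data.List.Relation.Unary.All as All using (All; []; _∷_; all?)
  open import Data.Vec using (Vec; toList) renaming ([] to []ᵥ; _∷_ to _∷ᵥ_)
  open import Data.Product using (_×_; _,_; proj₂)
  open import Data.Product.Properties using (≡-dec)
  open import Function using (_∘_; module Equivalence)
  open import Relation.Nullary using (Dec; yes; no; ¬_; _×-dec_)
  open import Relation.Unary using (Decidable)
  open import Relation.Binary.PropositionalEquality

  abovePoint? : Decidable AbovePoint
  abovePoint? (x , y) = x ≤? L ×-dec floorAt x ≤? y

  GoodFrom : Point → List Step → Set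
  GoodFrom p w = endFrom p w ≡ (L , L) × All AbovePoint (scanl move p w)

  goodFrom? : ∀ p w → Dec (GoodFrom p w)
  goodFrom? p w = ≡-dec _≟_ _≟_ (endFrom p w) (L , L) ×-dec all? abovePoint? (scanl move p w)

  words : (k : ℕ) → List (Vec Step k)
  words = vecsOver (N ∷ E ∷ [])

  goodCount : ℕ → Point → ℕ
  goodCount k p = length (filter (goodFrom? p ∘ toList) (words k))

  goodCount-step : ∀ k p → AbovePoint p →
                   goodCount (suc k) p ≡ goodCount k (move p N) + goodCount k (move p E)
  goodCount-step k p above = begin
      goodCount (suc k) p
    ≡⟨ cong length (filter-++ good (map (N ∷ᵥ_) (words k)) (map (E ∷ᵥ_) (words k) ++ [])) ⟩
      length (filter good (map (N ∷ᵥ_) (words k)) ++ filter good (map (E ∷ᵥ_) (words k) ++ []))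
    ≡⟨ length-++ (filter good (map (N ∷ᵥ_) (words k))) ⟩
      length (filter good (map (N ∷ᵥ_) (words k))) + length (filter good (map (E ∷ᵥ_) (words k) ++ []))
    ≡⟨ cong₂ _+_ (after N)
                 (trans (cong (length ∘ filter good) (++-identityʳ (map (E ∷ᵥ_) (words k)))) (after E)) ⟩
      goodCount k (move p N) + goodCount k (move p E) ∎
    where
    open ≡-Reasoning
    good = goodFrom? p ∘ toList
    after : ∀ s → length (filter good (map (s ∷ᵥ_) (words k))) ≡ goodCount k (move p s)
    after s = trans (length-filter-map good (s ∷ᵥ_) (words k))
      (cong length (filter-≐ (goodFrom? p ∘ (s ∷_) ∘ toList) (goodFrom? (move p s) ∘ toList)
        ((λ { (end , _ ∷ rest) → end , rest }) , (λ (end , rest) → end , above ∷ rest)) (words k)))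

  GoodFrom⇒Above : ∀ p w → GoodFrom p w → AbovePoint p
  GoodFrom⇒Above p []      (_ , above ∷ _) = above
  GoodFrom⇒Above p (_ ∷ _) (_ , above ∷ _) = above

  goodCount-below : ∀ k p → ¬ AbovePoint p → goodCount k p ≡ 0
  goodCount-below k p notAbove =
    cong length (filter-none (goodFrom? p ∘ toList)
      (All.universal (λ v → notAbove ∘ GoodFrom⇒Above p (toList v)) (words k)))

  endFrom-northward : ∀ p w → proj₂ p ≤ proj₂ (endFrom p w)
  endFrom-northward p       []      = ≤-refl
  endFrom-northward (x , y) (N ∷ w) = ≤-trans (n≤1+n y) (endFrom-northward (x , suc y) w)
  endFrom-northward (x , y) (E ∷ w) = endFrom-northward (suc x , y) w

  goodCount-aboveTop : ∀ k x y → L < y → goodCount k (x , y) ≡ 0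
  goodCount-aboveTop k x y L<y = cong length (filter-none (goodFrom? (x , y) ∘ toList)
    (All.universal (λ v (end , _) → <⇒≱ L<y (subst (λ p → y ≤ proj₂ p) end
                                                    (endFrom-northward (x , y) (toList v))))
                   (words k)))

  goodCount-topRow : ∀ k x → x + k ≡ L → goodCount k (x , L) ≡ 1
  goodCount-topRow zero    x x+0≡L rewrite trans (sym (+-identityʳ x)) x+0≡L =
    cong length (filter-accept (goodFrom? (L , L) ∘ toList) (refl , (≤-refl , floorAt≤ L) ∷ []))
  goodCount-topRow (suc k) x x+1+k≡L = begin
      goodCount (suc k) (x , L)
    ≡⟨ goodCount-step k (x , L) (x≤L , ≤-trans (floorAt≤ x) x≤L) ⟩
      goodCount k (x , suc L) + goodCount k (suc x , L)
    ≡⟨ cong₂ _+_ (goodCount-aboveTop k x (suc L) ≤-refl)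
                 (goodCount-topRow k (suc x) (trans (sym (+-suc x k)) x+1+k≡L)) ⟩
      1 ∎
    where
    open ≡-Reasoning
    x≤L : x ≤ L
    x≤L = subst (x ≤_) x+1+k≡L (m≤m+n x (suc k))

  -- (x , t + 1) is above the boundary iff x ≤ b t, so both sides satisfy the same recursion.
  goodCount≡paths : ∀ j t x e → suc t + j ≡ L → x + e ≡ L →
                    goodCount (j + e) (x , suc t) ≡ paths b j t x
  goodCount≡paths zero t x e t+1+0≡L x+e≡L =
    subst (λ y → goodCount e (x , y) ≡ 1) (sym (trans (sym (+-identityʳ (suc t))) t+1+0≡L))
          (goodCount-topRow e x x+e≡L)
  goodCount≡paths (suc j) t x e t+2+j≡L x+e≡L with x ≤? b t
  ... | no  x≰b = trans (goodCount-below (suc j + e) (x , suc t) (x≰b ∘ Above⇒≤b x t))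
                       (sym (paths-beyond b j t x (≰⇒> x≰b)))
  ... | yes x≤b = begin
      goodCount (suc (j + e)) (x , suc t)
    ≡⟨ goodCount-step (j + e) (x , suc t) (≤b⇒Above x t x≤b) ⟩
      goodCount (j + e) (x , suc (suc t)) + goodCount (j + e) (suc x , suc t)
    ≡⟨ cong₂ _+_ (goodCount≡paths j (suc t) x e (trans (sym (+-suc (suc t) j)) t+2+j≡L) x+e≡L)
                 (eastward e x+e≡L) ⟩
      paths b j (suc t) x + paths b (suc j) t (suc x)
    ≡⟨ sym (paths-split b j t x x≤b) ⟩
      paths b (suc j) t x ∎
    where
    open ≡-Reasoning
    eastward : ∀ e → x + e ≡ L → goodCount (j + e) (suc x , suc t) ≡ paths b (suc j) t (suc x)
    eastward zero    x+0≡L =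
      trans (goodCount-below (j + 0) (suc x , suc t) (λ (1+x≤L , _) → <-irrefl x≡L 1+x≤L))
      (sym (paths-beyond b j t (suc x) (s≤s (≤-trans (b≤L t) (≤-reflexive (sym x≡L))))))
      where
      x≡L : x ≡ L
      x≡L = trans (sym (+-identityʳ x)) x+0≡L
    eastward (suc e) x+1+e≡L = trans (cong (λ k → goodCount k (suc x , suc t)) (+-suc j e))
      (goodCount≡paths (suc j) t (suc x) e t+2+j≡L (trans (sym (+-suc x e)) x+1+e≡L))

  -- As L is a successor, 2 * L is definitionally suc (L ∸ 1 + (L + 0)); a good path starts with a north step.
  numPaths≡paths : numPaths m n ≡ paths b (L ∸ 1) 0 0
  numPaths≡paths = begin
      numPaths m n
    ≡⟨ cong length (filter-≐ (isGoodPath? m n) (goodFrom? (0 , 0) ∘ toList)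
                             (Equivalence.to (IsGoodPath⇔ _) , Equivalence.from (IsGoodPath⇔ _)) (words (2 * L))) ⟩
      goodCount (suc (L ∸ 1 + (L + 0))) (0 , 0)
    ≡⟨ goodCount-step (L ∸ 1 + (L + 0)) (0 , 0) (z≤n , z≤n) ⟩
      goodCount (L ∸ 1 + (L + 0)) (0 , 1) + goodCount (L ∸ 1 + (L + 0)) (1 , 0)
    ≡⟨ cong₂ _+_ (goodCount≡paths (L ∸ 1) 0 0 (L + 0) refl (+-identityʳ L))
                 (goodCount-below (L ∸ 1 + (L + 0)) (1 , 0) λ ()) ⟩
      paths b (L ∸ 1) 0 0 + 0
    ≡⟨ +-identityʳ _ ⟩
      paths b (L ∸ 1) 0 0 ∎
    where open ≡-Reasoning

module ColumnCondition (m′ n′ : ℕ) where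

  open import Defs using (Step; N; E; move; IsWall; isWall?)
  open Staircase m′ n′
  open Boundary m′ n′ using (AbovePoint; AllAbove)
  open Walks using (endFrom; All-scanl-++⁺; All-scanl-++⁻; All-scanl-last)
  open Words
    using (positions; positions-range; positions-++; endFrom-positions; nth; nth-++ˡ; nth-∷ʳ; nth-∈)
  open import Data.Nat
  open import Data.Nat.Properties
  open import Data.List using (List; []; _∷_; _++_; length)
  open import Data.List.Properties using (length-++; ++-identityʳ)
  open import Data.List.Reverse using (Reverse; []; _∶_∶ʳ_; reverseView)
  open import Data.List.Relation.Unary.All using ([]; _∷_)
  open import Data.Product using (_×_; _,_; proj₁; proj₂)
  open import Data.Sum using (_⊎_; inj₁; inj₂)
  open import Data.Empty using (⊥-elim)
  open import Function using (_⇔_; mk⇔; module Equivalence)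
  open import Relation.Nullary using (¬_; yes; no)
  open import Relation.Binary.PropositionalEquality

  ColumnsOK : List ℕ → List ℕ → Set
  ColumnsOK xs ys = ∀ c → c < length ys → ¬ IsWall m n (suc c) → c < length xs × nth xs c < nth ys c

  private
    length-∷ʳ : ∀ (xs : List ℕ) v → length (xs ++ v ∷ []) ≡ suc (length xs)
    length-∷ʳ xs v = trans (length-++ xs) (+-comm (length xs) 1)

    <-∷ʳ : ∀ {c} xs v → c < length (xs ++ v ∷ []) → c < length xs ⊎ c ≡ length xs
    <-∷ʳ xs v c<len = m≤n⇒m<n∨m≡n (≤-pred (subst (_ <_) (length-∷ʳ xs v) c<len))

  ColumnsOK-∷ʳ-east⁻ : ∀ xs ys v → ColumnsOK xs (ys ++ v ∷ []) →
                       ColumnsOK xs ys × (¬ IsWall m n (suc (length ys)) → length ys < length xs)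
  ColumnsOK-∷ʳ-east⁻ xs ys v ok = old , new
    where
    old : ColumnsOK xs ys
    old c c<len nonWall with ok c (subst (_ <_) (sym (length-∷ʳ ys v)) (<-trans c<len (n<1+n _))) nonWall
    ... | c<len′ , ordered = c<len′ , subst (nth xs c <_) (nth-++ˡ ys _ c<len) ordered
    new : ¬ IsWall m n (suc (length ys)) → length ys < length xs
    new nonWall = proj₁ (ok (length ys) (subst (length ys <_) (sym (length-∷ʳ ys v)) ≤-refl) nonWall)

  ColumnsOK-∷ʳ-east⁺ : ∀ xs ys v → ColumnsOK xs ys →
                       (¬ IsWall m n (suc (length ys)) → length ys < length xs) →
                       (∀ {c} → c < length xs → nth xs c < v) → ColumnsOK xs (ys ++ v ∷ [])
  ColumnsOK-∷ʳ-east⁺ xs ys v ok new xs<v c c<len nonWall with <-∷ʳ ys v c<len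
  ... | inj₁ c<len′ = let c<lenxs , ordered = ok c c<len′ nonWall in
                      c<lenxs , subst (nth xs c <_) (sym (nth-++ˡ ys _ c<len′)) ordered
  ... | inj₂ refl   = new nonWall , subst (nth xs c <_) (sym (nth-∷ʳ ys v)) (xs<v (new nonWall))

  ColumnsOK-∷ʳ-north⁻ : ∀ xs ys v → ColumnsOK (xs ++ v ∷ []) ys →
                        (∀ {c} → c < length ys → nth ys c < v) → ColumnsOK xs ys
  ColumnsOK-∷ʳ-north⁻ xs ys v ok ys<v c c<len nonWall with ok c c<len nonWall
  ... | c<len′ , ordered with <-∷ʳ xs v c<len′
  ...   | inj₁ c<lenxs = c<lenxs , subst (_< nth ys c) (nth-++ˡ xs _ c<lenxs) ordered
  ...   | inj₂ refl    = ⊥-elim (<-asym (subst (_< nth ys c) (nth-∷ʳ xs v) ordered) (ys<v c<len))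

  ColumnsOK-∷ʳ-north⁺ : ∀ xs ys v → ColumnsOK xs ys → ColumnsOK (xs ++ v ∷ []) ys
  ColumnsOK-∷ʳ-north⁺ xs ys v ok c c<len nonWall with ok c c<len nonWall
  ... | c<lenxs , ordered = subst (c <_) (sym (length-∷ʳ xs v)) (<-trans c<lenxs (n<1+n _)) ,
                            subst (_< nth ys c) (sym (nth-++ˡ xs _ c<lenxs)) ordered

  Above-east : ∀ {x y} → suc x ≤ L → Above x y → Above (suc x) y ⇔ (¬ IsWall m n (suc x) → x < y)
  Above-east {x} {y} 1+x≤L (_ , floor≤y) = mk⇔ forth back
    where
    forth : Above (suc x) y → ¬ IsWall m n (suc x) → x < y
    forth (_ , floor≤y′) nonWall = subst (_≤ y) (floorAt-nonWall x 1+x≤L nonWall) floor≤y′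
    back : (¬ IsWall m n (suc x) → x < y) → Above (suc x) y
    back x<y with isWall? m n (suc x)
    ... | yes wall    = 1+x≤L , subst (_≤ y) (sym (floorAt-wall x wall)) floor≤y
    ... | no  nonWall = 1+x≤L , subst (_≤ y) (sym (floorAt-nonWall x 1+x≤L nonWall)) (x<y nonWall)

  Above-north : ∀ {x y} → Above x y → Above x (suc y)
  Above-north (x≤L , floor≤y) = x≤L , ≤-trans floor≤y (n≤1+n _)

  eastCount northCount : List Step → ℕ
  eastCount  w = length (positions E 0 w)
  northCount w = length (positions N 0 w)

  endFrom-origin : ∀ w → endFrom (0 , 0) w ≡ (eastCount w , northCount w)
  endFrom-origin w = trans (endFrom-positions 0 w 0 0) (cong₂ _,_ (+-identityʳ _) (+-identityʳ _))

  AllAbove-∷ʳ⁻ : ∀ w s → AllAbove (w ++ s ∷ []) → AllAbove w × AbovePoint (move (endFrom (0 , 0) w) s)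
  AllAbove-∷ʳ⁻ w s all with All-scanl-++⁻ AbovePoint (0 , 0) w (s ∷ []) all
  ... | all₁ , _ ∷ above ∷ [] = all₁ , above

  AllAbove-∷ʳ⁺ : ∀ w s → AllAbove w → AbovePoint (move (endFrom (0 , 0) w) s) → AllAbove (w ++ s ∷ [])
  AllAbove-∷ʳ⁺ w s all above =
    All-scanl-++⁺ AbovePoint (0 , 0) w (s ∷ []) all (All-scanl-last AbovePoint (0 , 0) w all ∷ above ∷ [])

  ColumnsOK⇔AllAbove : List Step → Set
  ColumnsOK⇔AllAbove w = eastCount w ≤ L → ColumnsOK (positions N 0 w) (positions E 0 w) ⇔ AllAbove w

  ColumnsOK⇔AllAbove-∷ʳE : ∀ w → ColumnsOK⇔AllAbove w → ColumnsOK⇔AllAbove (w ++ E ∷ [])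
  ColumnsOK⇔AllAbove-∷ʳE w ih eastCount≤L = mk⇔ forth back
    where
    eᴱ : positions E 0 (w ++ E ∷ []) ≡ positions E 0 w ++ suc (length w) ∷ []
    eᴱ = positions-++ E 0 w (E ∷ [])
    eᴺ : positions N 0 (w ++ E ∷ []) ≡ positions N 0 w
    eᴺ = trans (positions-++ N 0 w (E ∷ [])) (++-identityʳ _)
    c<L : eastCount w < L
    c<L = subst (_≤ L) (trans (cong length eᴱ) (length-∷ʳ (positions E 0 w) _)) eastCount≤L
    IH = ih (<⇒≤ c<L)
    NewColumn : Set
    NewColumn = ¬ IsWall m n (suc (eastCount w)) → eastCount w < northCount w
    step : AllAbove w → AbovePoint (move (endFrom (0 , 0) w) E) ⇔ NewColumn
    step all = subst (λ p → AbovePoint (move p E) ⇔ NewColumn) (sym (endFrom-origin w))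
      (Above-east c<L (subst AbovePoint (endFrom-origin w) (All-scanl-last AbovePoint (0 , 0) w all)))
    forth : ColumnsOK (positions N 0 (w ++ E ∷ [])) (positions E 0 (w ++ E ∷ [])) → AllAbove (w ++ E ∷ [])
    forth ok with ColumnsOK-∷ʳ-east⁻ (positions N 0 w) (positions E 0 w) _ (subst₂ ColumnsOK eᴺ eᴱ ok)
    ... | okw , new = let allw = Equivalence.to IH okw in AllAbove-∷ʳ⁺ w E allw (Equivalence.from (step allw) new)
    back : AllAbove (w ++ E ∷ []) → ColumnsOK (positions N 0 (w ++ E ∷ [])) (positions E 0 (w ++ E ∷ []))
    back all with AllAbove-∷ʳ⁻ w E all
    ... | allw , above = subst₂ ColumnsOK (sym eᴺ) (sym eᴱ)
      (ColumnsOK-∷ʳ-east⁺ (positions N 0 w) (positions E 0 w) _ (Equivalence.from IH allw)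
        (Equivalence.to (step allw) above) (λ c<len → s≤s (proj₂ (positions-range N 0 w (nth-∈ _ c<len)))))

  ColumnsOK⇔AllAbove-∷ʳN : ∀ w → ColumnsOK⇔AllAbove w → ColumnsOK⇔AllAbove (w ++ N ∷ [])
  ColumnsOK⇔AllAbove-∷ʳN w ih eastCount≤L = mk⇔ forth back
    where
    eᴺ : positions N 0 (w ++ N ∷ []) ≡ positions N 0 w ++ suc (length w) ∷ []
    eᴺ = positions-++ N 0 w (N ∷ [])
    eᴱ : positions E 0 (w ++ N ∷ []) ≡ positions E 0 w
    eᴱ = trans (positions-++ E 0 w (N ∷ [])) (++-identityʳ _)
    IH = ih (subst (_≤ L) (cong length eᴱ) eastCount≤L)
    forth : ColumnsOK (positions N 0 (w ++ N ∷ [])) (positions E 0 (w ++ N ∷ [])) → AllAbove (w ++ N ∷ [])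
    forth ok = AllAbove-∷ʳ⁺ w N allw (Above-north (All-scanl-last AbovePoint (0 , 0) w allw))
      where
      allw = Equivalence.to IH (ColumnsOK-∷ʳ-north⁻ (positions N 0 w) (positions E 0 w) _
        (subst₂ ColumnsOK eᴺ eᴱ ok) (λ c<len → s≤s (proj₂ (positions-range E 0 w (nth-∈ _ c<len)))))
    back : AllAbove (w ++ N ∷ []) → ColumnsOK (positions N 0 (w ++ N ∷ [])) (positions E 0 (w ++ N ∷ []))
    back all = subst₂ ColumnsOK (sym eᴺ) (sym eᴱ)
      (ColumnsOK-∷ʳ-north⁺ (positions N 0 w) (positions E 0 w) _
        (Equivalence.from IH (proj₁ (AllAbove-∷ʳ⁻ w N all))))

  columnsOK⇔allAbove : ∀ w → ColumnsOK⇔AllAbove w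
  columnsOK⇔allAbove w = byReverse (reverseView w)
    where
    byReverse : ∀ {w} → Reverse w → ColumnsOK⇔AllAbove w
    byReverse []           _ = mk⇔ (λ _ → (z≤n , z≤n) ∷ []) (λ _ c ())
    byReverse (w ∶ r ∶ʳ E) = ColumnsOK⇔AllAbove-∷ʳE w (byReverse r)
    byReverse (w ∶ r ∶ʳ N) = ColumnsOK⇔AllAbove-∷ʳN w (byReverse r)

module Tableaux (m′ n′ : ℕ) where

  open import Defs
  open Staircase m′ n′
  open Boundary m′ n′ using (AllAbove; IsGoodPath⇔)
  open ColumnCondition m′ n′
  open Walks using (endFrom)
  open Words
  open Enumeration
    using (count-bijection; allFillings-unique; vecsOver-unique; ∈-vecsOver⁺; ∈-allFillings⁺; ∈-allFillings⁻;
           ∈-oneTo⁺; ∈-oneTo⁻; segment)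
  open import Data.Nat
  open import Data.Nat.Properties
  open import Data.Fin using (Fin; toℕ; fromℕ<)
  open import Data.Fin.Properties using (toℕ<n; toℕ-fromℕ<)
  open import Data.List using (List; []; _∷_; _++_; length; map)
  open import Data.List.Relation.Unary.All as All using (All; []; _∷_)
  open import Data.List.Relation.Unary.AllPairs using (AllPairs; []; _∷_)
  open import Data.List.Relation.Unary.Any using (here; there)
  open import Data.List.Relation.Unary.Linked using (Linked)
  open import Data.List.Relation.Unary.Linked.Properties using (AllPairs⇒Linked; Linked⇒AllPairs)
  open import Data.List.Relation.Unary.Unique.Propositional using (Unique)
  open import Data.List.Membership.Propositional using (_∈_)
  open import Data.List.Membership.DecPropositional _≟_ using (_∈?_)
  open import Data.Vec using (Vec; toList; lookup) renaming (_++_ to _++ᵥ_; [] to []ᵥ; _∷_ to _∷ᵥ_)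
  import Data.Vec.Properties as Vec
  open import Data.Product using (_×_; _,_; proj₁; proj₂)
  open import Function using (_∘_; id; _⇔_; mk⇔; module Equivalence)
  open import Function.Construct.Composition using (_⇔-∘_)
  open import Relation.Nullary using (¬_; ¬?)
  open import Relation.Binary.PropositionalEquality

  wordToFilling : Vec Step (2 * L) → Filling m n
  wordToFilling w = pad L (positions N 0 (toList w)) , pad L (positions E 0 (toList w))

  fillingToWord : Filling m n → Vec Step (2 * L)
  fillingToWord (r₁ , r₂) = stepsAt (indicator (_∈? toList r₁)) 0 (2 * L)

  Balanced : Vec Step (2 * L) → Set
  Balanced w = endFrom (0 , 0) (toList w) ≡ (L , L)

  module _ (w : Vec Step (2 * L)) (balanced : Balanced w) where

    private
      north east : List ℕ
      north = positions N 0 (toList w)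
      east  = positions E 0 (toList w)

      counts : eastCount (toList w) ≡ L × northCount (toList w) ≡ L
      counts = let e = trans (sym (endFrom-origin (toList w))) balanced in cong proj₁ e , cong proj₂ e

      length-w : length (toList w) ≡ 2 * L
      length-w = Vec.length-toList w

      toList-row : ∀ s → toList (pad L (positions s 0 (toList w))) ≡ positions s 0 (toList w)
      toList-row N = toList-pad L _ (proj₂ counts)
      toList-row E = toList-pad L _ (proj₁ counts)

      lookup-row : ∀ s (k : Fin L) →
                   lookup (pad L (positions s 0 (toList w))) k ≡ nth (positions s 0 (toList w)) (toℕ k)
      lookup-row s = lookup-pad L (positions s 0 (toList w))

    wordToFilling-∈ : wordToFilling w ∈ allFillings m n
    wordToFilling-∈ = ∈-allFillings⁺ m n (inRange N) (inRange E)
      where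
      inRange : ∀ s → All (_∈ oneTo (2 * L)) (toList (pad L (positions s 0 (toList w))))
      inRange s = subst (All (_∈ oneTo (2 * L))) (sym (toList-row s)) (All.tabulate λ v∈ →
        let 0<v , v≤ = positions-range s 0 (toList w) v∈ in ∈-oneTo⁺ 0<v (subst (_ ≤_) length-w v≤))

    fillingToWord∘wordToFilling : fillingToWord (wordToFilling w) ≡ w
    fillingToWord∘wordToFilling = trans (sym (Vec.cast-is-id refl _)) (Vec.toList-injective refl _ w (begin
        toList (stepsAt (indicator (_∈? toList (pad L north))) 0 (2 * L))
      ≡⟨ toList-stepsAt _ 0 (2 * L) ⟩
        map (indicator (_∈? toList (pad L north))) (segment 0 (2 * L))
      ≡⟨ cong₂ (λ xs k → map (indicator (_∈? xs)) (segment 0 k)) (toList-row N) (sym length-w) ⟩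
        map (indicator (_∈? north)) (segment 0 (length (toList w)))
      ≡⟨ map-indicator-positions (_∈? north) 0 (toList w) (λ _ _ → mk⇔ id id) ⟩
        toList w ∎))
      where open ≡-Reasoning

    columnsOK⇒tableau : ColumnsOK north east → IsTableauWithWalls m n (wordToFilling w)
    columnsOK⇒tableau ok = once , sorted N , sorted E , columns
      where
      once : All (λ v → occurrences v (toList (pad L north ++ᵥ pad L east)) ≡ 1) (oneTo (2 * L))
      once = All.tabulate λ {v} v∈ → let 0<v , v≤2L = ∈-oneTo⁻ v∈ in begin
          occurrences v (toList (pad L north ++ᵥ pad L east))
        ≡⟨ cong (occurrences v) (trans (Vec.toList-++ (pad L north) (pad L east))
                                       (cong₂ _++_ (toList-row N) (toList-row E))) ⟩
          occurrences v (north ++ east)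
        ≡⟨ occurrences-++ v north east ⟩
          occurrences v north + occurrences v east
        ≡⟨ occurrences-positions 0 (toList w) 0<v (subst (v ≤_) (sym length-w) v≤2L) ⟩
          1 ∎
        where open ≡-Reasoning
      sorted : ∀ s → Linked _<_ (toList (pad L (positions s 0 (toList w))))
      sorted s = subst (Linked _<_) (sym (toList-row s)) (AllPairs⇒Linked (positions-sorted s 0 (toList w)))
      columns : (k : Fin L) → ¬ IsWall m n (suc (toℕ k)) → lookup (pad L north) k < lookup (pad L east) k
      columns k nonWall = subst₂ _<_ (sym (lookup-row N k)) (sym (lookup-row E k))
        (proj₂ (ok (toℕ k) (subst (toℕ k <_) (sym (proj₁ counts)) (toℕ<n k)) nonWall))

    tableau⇒columnsOK : IsTableauWithWalls m n (wordToFilling w) → ColumnsOK north east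
    tableau⇒columnsOK (_ , _ , _ , columns) c c<L nonWall =
      subst (c <_) (sym (proj₂ counts)) c<L′ ,
      subst₂ _<_ (trans (lookup-row N k) (cong (nth north) (toℕ-fromℕ< c<L′)))
                 (trans (lookup-row E k) (cong (nth east) (toℕ-fromℕ< c<L′)))
        (columns k (subst (λ c → ¬ IsWall m n (suc c)) (sym (toℕ-fromℕ< c<L′)) nonWall))
      where
      c<L′ : c < L
      c<L′ = subst (c <_) (proj₁ counts) c<L
      k : Fin L
      k = fromℕ< c<L′

    tableau⇔allAbove : IsTableauWithWalls m n (wordToFilling w) ⇔ AllAbove (toList w)
    tableau⇔allAbove =
      columnsOK⇔allAbove (toList w) (≤-reflexive (proj₁ counts)) ⇔-∘ mk⇔ tableau⇒columnsOK columnsOK⇒tableau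

  module _ {r₁ r₂ : Vec ℕ L} (t∈ : (r₁ , r₂) ∈ allFillings m n)
           (tableau : IsTableauWithWalls m n (r₁ , r₂)) where

    private
      word : List Step
      word = toList (fillingToWord (r₁ , r₂))

      inRange : ∀ {r : Vec ℕ L} → All (_∈ oneTo (2 * L)) (toList r) →
                ∀ {u} → u ∈ toList r → 0 < u × u ≤ 0 + 2 * L
      inRange r∈ u∈ = ∈-oneTo⁻ (All.lookup r∈ u∈)

      partition : ∀ {u} → 0 < u → u ≤ 0 + 2 * L → (u ∈ toList r₂) ⇔ (¬ u ∈ toList r₁)
      partition 0<u u≤ = occurrences-once⇒partition (toList r₁) (toList r₂)
        (trans (cong (occurrences _) (sym (Vec.toList-++ r₁ r₂)))
               (All.lookup (proj₁ tableau) (∈-oneTo⁺ 0<u u≤)))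

      sorted : ∀ {r : Vec ℕ L} → Linked _<_ (toList r) → AllPairs _<_ (toList r)
      sorted = Linked⇒AllPairs <-trans

      positionsᴺ : positions N 0 word ≡ toList r₁
      positionsᴺ = trans (cong (positions N 0) (toList-stepsAt _ 0 (2 * L)))
        (trans (positions-indicatorᴺ (_∈? toList r₁) 0 (2 * L))
          (filter-segment (_∈? toList r₁) 0 (2 * L) (sorted (proj₁ (proj₂ tableau)))
            (mk⇔ (λ u∈ → u∈ , inRange (proj₁ (∈-allFillings⁻ m n t∈)) u∈) proj₁)))

      positionsᴱ : positions E 0 word ≡ toList r₂
      positionsᴱ = trans (cong (positions E 0) (toList-stepsAt _ 0 (2 * L)))
        (trans (positions-indicatorᴱ (_∈? toList r₁) 0 (2 * L))
          (filter-segment (¬? ∘ (_∈? toList r₁)) 0 (2 * L) (sorted (proj₁ (proj₂ (proj₂ tableau))))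
            (mk⇔ (λ u∈ → let 0<u , u≤ = inRange (proj₂ (∈-allFillings⁻ m n t∈)) u∈ in
                         Equivalence.to (partition 0<u u≤) u∈ , 0<u , u≤)
                 (λ (u∉ , 0<u , u≤) → Equivalence.from (partition 0<u u≤) u∉))))

    wordToFilling∘fillingToWord : wordToFilling (fillingToWord (r₁ , r₂)) ≡ (r₁ , r₂)
    wordToFilling∘fillingToWord =
      cong₂ _,_ (trans (cong (pad L) positionsᴺ) (pad-toList r₁))
                (trans (cong (pad L) positionsᴱ) (pad-toList r₂))

    fillingToWord-balanced : Balanced (fillingToWord (r₁ , r₂))
    fillingToWord-balanced = trans (endFrom-origin word)
      (cong₂ _,_ (trans (cong length positionsᴱ) (Vec.length-toList r₂))
                 (trans (cong length positionsᴺ) (Vec.length-toList r₁)))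

  fBar≡numPaths : fBar m n ≡ numPaths m n
  fBar≡numPaths = count-bijection (isTableauWithWalls? m n) (isGoodPath? m n) fillingToWord wordToFilling
    (allFillings-unique m n) (vecsOver-unique _ steps-unique (2 * L)) forth back
    where
    steps-unique : Unique (N ∷ E ∷ [])
    steps-unique = ((λ ()) ∷ []) ∷ [] ∷ []
    allSteps : ∀ {k} (v : Vec Step k) → All (_∈ N ∷ E ∷ []) (toList v)
    allSteps []ᵥ       = []
    allSteps (N ∷ᵥ v) = here refl ∷ allSteps v
    allSteps (E ∷ᵥ v) = there (here refl) ∷ allSteps v
    forth : ∀ {t} → t ∈ allFillings m n → IsTableauWithWalls m n t →
            fillingToWord t ∈ vecsOver (N ∷ E ∷ []) (2 * L) × IsGoodPath m n (fillingToWord t) ×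
            wordToFilling (fillingToWord t) ≡ t
    forth {r₁ , r₂} t∈ tableau = ∈-vecsOver⁺ _ _ (allSteps _) ,
      Equivalence.from (IsGoodPath⇔ w) (balanced , Equivalence.to (tableau⇔allAbove w balanced)
        (subst (IsTableauWithWalls m n) (sym (wordToFilling∘fillingToWord t∈ tableau)) tableau)) ,
      wordToFilling∘fillingToWord t∈ tableau
      where
      w = fillingToWord (r₁ , r₂)
      balanced = fillingToWord-balanced t∈ tableau
    back : ∀ {w} → w ∈ vecsOver (N ∷ E ∷ []) (2 * L) → IsGoodPath m n w →
           wordToFilling w ∈ allFillings m n × IsTableauWithWalls m n (wordToFilling w) ×
           fillingToWord (wordToFilling w) ≡ w
    back {w} _ good with Equivalence.to (IsGoodPath⇔ w) good
    ... | balanced , above =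
      wordToFilling-∈ w balanced , Equivalence.from (tableau⇔allAbove w balanced) above ,
      fillingToWord∘wordToFilling w balanced

open import Defs
open import Data.Nat using (ℕ; suc; _+_; _*_; _∸_; NonZero)
open import Data.Nat.Properties using (+-comm)
open import Data.Integer using (+_; _⊖_; _-_) renaming (_+_ to _+ℤ_)
open import Data.Integer.Properties using (distribˡ-⊖-+-pos; [1+m]⊖[1+n]≡m⊖n)
open import Data.Fin using (toℕ)
open import Data.Product using (_×_; _,_)
open import Relation.Binary.PropositionalEquality
open Determinants using (detℕ; det-cong)
open BoundedPaths using (paths)
open BinomialDeterminant using (binomialMatrix; det-binomialMatrix)

wallMatrixIndex : ∀ r c → (+ suc c - + suc r) +ℤ + 1 ≡ suc c ⊖ r
wallMatrixIndex r c =
  trans (distribˡ-⊖-+-pos 1 (suc c) (suc r)) (trans ([1+m]⊖[1+n]≡m⊖n (c + 1) r) (cong (_⊖ r) (+-comm c 1)))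

proposition2p5 : (m n : ℕ) → .{{_ : NonZero m}} → .{{_ : NonZero n}} →
    (fBar m n ≡ numPaths m n) × (+ fBar m n ≡ det (m * n ∸ 1) (wallMatrix m n))
proposition2p5 (suc m′) (suc n′) = fBar≡numPaths , (begin
    + fBar m n                        ≡⟨ cong +_ (trans fBar≡numPaths numPaths≡paths) ⟩
    + paths b (L ∸ 1) 0 0             ≡⟨ det-binomialMatrix b b-mono (L ∸ 1) 0 ⟨
    detℕ (L ∸ 1) (binomialMatrix b)   ≡⟨ det-cong (L ∸ 1) wallMatrix≡ ⟩
    det (m * n ∸ 1) (wallMatrix m n)  ∎)
  where
  open ≡-Reasoning
  open Staircase m′ n′ using (m; n; L; b; b-mono)
  open GoodPaths m′ n′ using (numPaths≡paths)
  open Tableaux m′ n′ using (fBar≡numPaths)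
  wallMatrix≡ : ∀ i j → binomialMatrix b (toℕ i) (toℕ j) ≡ wallMatrix m n i j
  wallMatrix≡ i j = sym (cong₂ binomℤ (+-comm (b (toℕ i)) 1) (wallMatrixIndex (toℕ i) (toℕ j)))
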